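{- Let $n_1,n_2,d\ge1$ be integers with $\operatorname{lcm}(n_1,d)\ne\operatorname{lcm}(n_2,d)$. Then $\sum_{b\in d\mathbb{Z}/n_1n_2d\mathbb{Z}}T_b(n_1)T_b(n_2)=0$.
   Context: $F_0(\mathbf{y})=y_1^3+y_2^3+y_3^3$, $F_b=F_0-b$, $e_n(t)=e^{2\pi it/n}$. $T_b(n)=\sum_{u\in(\mathbb{Z}/n\mathbb{Z})^\times}\sum_{\mathbf{y}\in(\mathbb{Z}/n\mathbb{Z})^3}e_n(uF_b(\mathbf{y}))$ (well defined for $b$ a residue modulo any multiple of $n$). $d\mathbb{Z}/N\mathbb{Z}$ denotes the residues modulo $N$ divisible by $d$. -}

module Defs where

open import Data.Nat as ℕ using (ℕ; zero; suc)
open import Data.Nat.Divisibility using (_∣?_)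
open import Data.Nat.GCD using (gcd)
import Data.Nat.DivMod as NDM
open import Data.Integer as ℤ using (ℤ; +_; 0ℤ; 1ℤ)
open import Data.Integer.DivMod using (_%ℕ_)
open import Data.List using (List; []; _∷_; [_]; _++_; replicate; foldr; map; upTo; concatMap; length; reverse; filter; applyUpTo)
open import Data.Bool using (Bool; true; false; if_then_else_)
open import Relation.Nullary.Decidable using (does; ⌊_⌋)
open import Relation.Binary.PropositionalEquality using (_≡_)

-- All quantities in the
-- statement are ℤ-linear combinations of powers of ζ_M = e^{2πi/M},
-- where M = n₁ n₂ d.  We represent such a number by a polynomial
-- p ∈ ℤ[x] (list of coefficients, lowest degree first), standing for
-- the complex number p(ζ_M).  Since the minimal polynomial of ζ_M over
-- ℚ is the cyclotomic polynomial Φ_M (monic, in ℤ[x]), we have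
--   p(ζ_M) = 0 in ℂ  ⟺  Φ_M divides p  ⟺  p mod Φ_M = 0.

Poly : Set
Poly = List ℤ

infixl 6 _⊕_
infixl 7 _⊗_

_⊕_ : Poly → Poly → Poly
[]       ⊕ q        = q
(a ∷ p)  ⊕ []       = a ∷ p
(a ∷ p)  ⊕ (b ∷ q)  = (a ℤ.+ b) ∷ (p ⊕ q)

scale : ℤ → Poly → Poly
scale c = map (c ℤ.*_)

neg : Poly → Poly
neg = scale (ℤ.- 1ℤ)

shift : ℕ → Poly → Poly
shift k p = replicate k 0ℤ ++ p

_⊗_ : Poly → Poly → Poly
[]      ⊗ q = []
(a ∷ p) ⊗ q = scale a q ⊕ shift 1 (p ⊗ q)

mono : ℕ → Poly
mono k = shift k [ 1ℤ ]

one : Poly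
one = [ 1ℤ ]

sumP : List Poly → Poly
sumP = foldr _⊕_ []

prodP : List Poly → Poly
prodP = foldr _⊗_ one

dropZeros : List ℤ → List ℤ
dropZeros []      = []
dropZeros (a ∷ p) = if ⌊ a ℤ.≟ 0ℤ ⌋ then dropZeros p else a ∷ p

strip : Poly → Poly
strip p = reverse (dropZeros (reverse p))

leading : Poly → ℤ
leading p with reverse (strip p)
... | []    = 0ℤ
... | a ∷ _ = a

-- Long division by a monic polynomial q (fuel-bounded); returns
-- (quotient , remainder).  With fuel ≥ length p the result is exact.
record QR : Set where
  constructor _,_
  field quo rem : Poly

divMonic : ℕ → Poly → Poly → QR
divMonic zero    p q = [] , strip p
divMonic (suc f) p q =
  let p' = strip p ; q' = strip q in
  if length p' ℕ.<ᵇ length q'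
  then ([] , p')
  else (let k  = length p' ℕ.∸ length q'
            c  = leading p'
            t  = shift k [ c ]
            r  = divMonic f (p' ⊕ neg (t ⊗ q')) q'
        in (t ⊕ QR.quo r) , QR.rem r)

quotM : Poly → Poly → Poly
quotM p q = QR.quo (divMonic (length p) p q)

remM : Poly → Poly → Poly
remM p q = QR.rem (divMonic (length p) p q)

properDivisors : ℕ → List ℕ
properDivisors n = filter (λ d → d ∣? n) (applyUpTo suc (n ℕ.∸ 1))

-- Cyclotomic polynomials via x^n - 1 = ∏_{d ∣ n} Φ_d :
--   Φ_n = (x^n - 1) / ∏_{d ∣ n, d < n} Φ_d     (n ≥ 1)
cycFuel : ℕ → ℕ → Poly
cycFuel zero    n = one
cycFuel (suc f) n =
  quotM (mono n ⊕ neg one) (prodP (map (cycFuel f) (properDivisors n)))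

Φ : ℕ → Poly
Φ n = cycFuel n n

-- "p(ζ_M) = 0 in ℂ", where ζ_M = e^{2πi/M}
VanishesAt : ℕ → Poly → Set
VanishesAt M p = strip (remM p (Φ M)) ≡ []

-- total versions of division/modulus (only used with nonzero divisors)
_divN_ : ℕ → ℕ → ℕ
m divN zero    = 0
m divN (suc k) = m NDM./ suc k

_modZ_ : ℤ → ℕ → ℕ
z modZ zero    = 0
z modZ (suc k) = z %ℕ suc k

-- e_n(t) = e^{2πi t/n} = ζ_M^{(M/n) t}   (for n ∣ M), as an element
-- of ℤ[ζ_M] represented by a monomial.
e : (M n : ℕ) → ℤ → Poly
e M n t = mono ((+ (M divN n) ℤ.* t) modZ M)

F : ℤ → ℤ → ℤ → ℤ → ℤ
F b y₁ y₂ y₃ = y₁ ℤ.* y₁ ℤ.* y₁ ℤ.+ y₂ ℤ.* y₂ ℤ.* y₂ ℤ.+ y₃ ℤ.* y₃ ℤ.* y₃ ℤ.- b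

-- (ℤ/nℤ)^× , residues represented by 0,…,n-1
units : ℕ → List ℕ
units n = filter (λ u → gcd u n ℕ.≟ 1) (upTo n)

-- T_b(n) = Σ_{u ∈ (ℤ/nℤ)^×} Σ_{y ∈ (ℤ/nℤ)^3} e_n(u F_b(y)),
-- as an element of ℤ[ζ_M] (n ∣ M).
T : (M : ℕ) → (b : ℤ) → (n : ℕ) → Poly
T M b n =
  sumP (concatMap (λ u →
  concatMap (λ y₁ →
  concatMap (λ y₂ →
  map (λ y₃ → e M n (+ u ℤ.* F b (+ y₁) (+ y₂) (+ y₃)))
      (upTo n)) (upTo n)) (upTo n)) (units n))

-- Σ_{b ∈ dℤ/n₁n₂dℤ} T_b(n₁) T_b(n₂) ; b runs over d·k, 0 ≤ k < n₁n₂,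
-- as an element of ℤ[ζ_M] with M = n₁ n₂ d.
S : ℕ → ℕ → ℕ → Poly
S n₁ n₂ d =
  let M = n₁ ℕ.* n₂ ℕ.* d in
  sumP (map (λ k → T M (+ (d ℕ.* k)) n₁ ⊗ T M (+ (d ℕ.* k)) n₂)
            (upTo (n₁ ℕ.* n₂)))

{-# OPTIONS --safe #-}

-- Let M = n₁n₂d and ζ = e^{2πi/M}. Every quantity is a polynomial in ζ, and it vanishes exactly
-- when Φ_M divides the polynomial. Expanding T_b(n₁)T_b(n₂) for b = dk and summing over k first,
-- each term becomes a power of ζ times G = Σ_{k<n₁n₂} ζ^{−γk} with γ = d²(n₂u₁ + n₁u₂). Since M
-- divides n₁n₂γ, multiplication by ζ^γ permutes the terms of G, so (ζ^γ − 1)G = 0; and ζ^γ ≠ 1,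
-- because M ∣ γ would give n₁n₂ ∣ d(n₂u₁ + n₁u₂), which for units u₁, u₂ forces
-- lcm(n₁, d) = lcm(n₂, d). In ℤ[x]: Φ_M divides (x^a − 1)G for some 0 < a < M, and Φ_M is coprime
-- over ℚ to x^a − 1, so Φ_M divides G. That coprimality rests on x^n − 1 = ∏_{d∣n} Φ_d for the
-- recursively computed Φ, proved by strong induction together with the pairwise coprimality of
-- distinct Φ_d.

module Submission where

open import Defs
open import Algebra.Bundles using (CommutativeRing)
open import Algebra.Solver.Ring.AlmostCommutativeRing
  using (AlmostCommutativeRing; _-Raw-AlmostCommutative⟶_; fromCommutativeRing; Induced-equivalence)
open import Data.Bool using (true; false) renaming (T to IsTrue)
open import Data.Empty using (⊥-elim)
open import Data.Integer as ℤ using (ℤ; +_; -[1+_]; 0ℤ; 1ℤ; -_; +-*-rawRing)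
  renaming (_+_ to _+ℤ_; _*_ to _*ℤ_)
import Data.Integer.Properties as ℤP
open import Data.Integer.DivMod using (_%ℕ_; _/ℕ_; a≡a%ℕn+[a/ℕn]*n)
import Data.Integer.Solver as ℤSolver
open import Data.List using (List; []; _∷_; [_]; _++_; replicate; length; reverse; map; foldr; filter; applyUpTo; upTo; concatMap)
open import Data.List.Properties
  using ( length-++; length-replicate; reverse-++; unfold-reverse; reverse-involutive
        ; filter-accept; filter-++; map-++; applyUpTo-∷ʳ; map-concatMap; concatMap-cong; map-∘)
open import Data.List.Relation.Unary.All as All using (All; []; _∷_)
import Data.List.Relation.Unary.All.Properties as AllP
open import Data.List.Relation.Unary.AllPairs using (AllPairs; []; _∷_)
open import Data.List.Relation.Unary.Unique.Propositional using (Unique)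
import Data.List.Relation.Unary.Unique.Propositional.Properties as UniqueP
open import Data.Maybe using (just; nothing)
open import Data.Nat as ℕ using (ℕ; zero; suc; _≤_; _<_; z≤n; s≤s; _+_; _∸_; _*_)
import Data.Nat.Properties as ℕP
import Data.Nat.DivMod as ℕDivMod
open import Data.Nat.Induction using (<-rec)
open import Data.Nat.Divisibility
open import Data.Nat.GCD
  using (gcd; gcd-GCD; module Bézout; gcd[m,n]∣m; gcd[m,n]∣n; gcd-comm; gcd-greatest; c*gcd[m,n]≡gcd[cm,cn]; gcd[m,n]≢0)
open import Data.Nat.LCM using (lcm; gcd*lcm; lcm-least; n∣lcm[m,n])
import Data.Nat.Solver as ℕSolver
open import Data.Product using (Σ; _×_; _,_; proj₁; proj₂)
open import Data.Sum using (_⊎_; inj₁; inj₂)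
open import Data.Unit using (⊤; tt)
open import Function using (_∘_; case_of_)
import Relation.Binary.Reasoning.Setoid as SetoidReasoning
open import Relation.Binary.Definitions using (WeaklyDecidable; tri<; tri≈; tri>)
open import Relation.Binary.PropositionalEquality hiding ([_])
open import Relation.Nullary using (¬_; yes; no)
open import Relation.Unary using (Decidable)

module Polynomials where

  coeff : Poly → ℕ → ℤ
  coeff []      i       = 0ℤ
  coeff (a ∷ p) zero    = a
  coeff (a ∷ p) (suc i) = coeff p i

  infix 4 _≈_
  record _≈_ (p q : Poly) : Set where
    constructor coeffwise
    field at : ∀ i → coeff p i ≡ coeff q i
  open _≈_ public

  ≈-refl : ∀ {p} → p ≈ p
  ≈-refl = coeffwise λ _ → refl

  ≈-sym : ∀ {p q} → p ≈ q → q ≈ p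
  ≈-sym e = coeffwise λ i → sym (at e i)

  ≈-trans : ∀ {p q r} → p ≈ q → q ≈ r → p ≈ r
  ≈-trans e f = coeffwise λ i → trans (at e i) (at f i)

  ≡⇒≈ : ∀ {p q} → p ≡ q → p ≈ q
  ≡⇒≈ refl = ≈-refl

  ∷-cong : ∀ {a b p q} → a ≡ b → p ≈ q → (a ∷ p) ≈ (b ∷ q)
  ∷-cong a≡b p≈q = coeffwise λ { zero → a≡b ; (suc i) → at p≈q i }

  0∷-≈[] : ∀ {a p} → a ≡ 0ℤ → p ≈ [] → (a ∷ p) ≈ []
  0∷-≈[] a≡0 p≈[] = coeffwise λ { zero → a≡0 ; (suc i) → at p≈[] i }

  coeff-⊕ : ∀ p q i → coeff (p ⊕ q) i ≡ coeff p i +ℤ coeff q i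
  coeff-⊕ []      q       i       = sym (ℤP.+-identityˡ _)
  coeff-⊕ (a ∷ p) []      i       = sym (ℤP.+-identityʳ _)
  coeff-⊕ (a ∷ p) (b ∷ q) zero    = refl
  coeff-⊕ (a ∷ p) (b ∷ q) (suc i) = coeff-⊕ p q i

  coeff-scale : ∀ c p i → coeff (scale c p) i ≡ c *ℤ coeff p i
  coeff-scale c []      i       = sym (ℤP.*-zeroʳ c)
  coeff-scale c (a ∷ p) zero    = refl
  coeff-scale c (a ∷ p) (suc i) = coeff-scale c p i

  coeff-neg : ∀ p i → coeff (neg p) i ≡ - coeff p i
  coeff-neg p i = trans (coeff-scale (- 1ℤ) p i) (ℤP.-1*i≡-i (coeff p i))

  coeff-∷⊗ : ∀ a p q i → coeff ((a ∷ p) ⊗ q) i ≡ a *ℤ coeff q i +ℤ coeff (0ℤ ∷ (p ⊗ q)) i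
  coeff-∷⊗ a p q i =
    trans (coeff-⊕ (scale a q) (0ℤ ∷ (p ⊗ q)) i) (cong (_+ℤ coeff (0ℤ ∷ (p ⊗ q)) i) (coeff-scale a q i))

  ⊕-cong : ∀ {p p′ q q′} → p ≈ p′ → q ≈ q′ → (p ⊕ q) ≈ (p′ ⊕ q′)
  ⊕-cong {p} {p′} {q} {q′} e f = coeffwise λ i →
    trans (coeff-⊕ p q i) (trans (cong₂ _+ℤ_ (at e i) (at f i)) (sym (coeff-⊕ p′ q′ i)))

  ⊕-assoc : ∀ p q r → ((p ⊕ q) ⊕ r) ≈ (p ⊕ (q ⊕ r))
  ⊕-assoc p q r = coeffwise λ i → begin
    coeff ((p ⊕ q) ⊕ r) i                  ≡⟨ coeff-⊕ (p ⊕ q) r i ⟩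
    coeff (p ⊕ q) i +ℤ coeff r i           ≡⟨ cong (_+ℤ coeff r i) (coeff-⊕ p q i) ⟩
    coeff p i +ℤ coeff q i +ℤ coeff r i    ≡⟨ ℤP.+-assoc (coeff p i) _ _ ⟩
    coeff p i +ℤ (coeff q i +ℤ coeff r i)  ≡⟨ cong (coeff p i +ℤ_) (coeff-⊕ q r i) ⟨
    coeff p i +ℤ coeff (q ⊕ r) i           ≡⟨ coeff-⊕ p (q ⊕ r) i ⟨
    coeff (p ⊕ (q ⊕ r)) i                  ∎
    where open ≡-Reasoning

  ⊕-comm : ∀ p q → (p ⊕ q) ≈ (q ⊕ p)
  ⊕-comm p q = coeffwise λ i →
    trans (coeff-⊕ p q i) (trans (ℤP.+-comm (coeff p i) _) (sym (coeff-⊕ q p i)))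

  ⊕-identityˡ : ∀ p → ([] ⊕ p) ≈ p
  ⊕-identityˡ p = ≈-refl

  ⊕-identityʳ : ∀ p → (p ⊕ []) ≈ p
  ⊕-identityʳ p = coeffwise λ i → trans (coeff-⊕ p [] i) (ℤP.+-identityʳ _)

  neg-cong : ∀ {p q} → p ≈ q → neg p ≈ neg q
  neg-cong {p} {q} e = coeffwise λ i →
    trans (coeff-neg p i) (trans (cong -_ (at e i)) (sym (coeff-neg q i)))

  ⊕-inverseˡ : ∀ p → (neg p ⊕ p) ≈ []
  ⊕-inverseˡ p = coeffwise λ i →
    trans (coeff-⊕ (neg p) p i) (trans (cong (_+ℤ coeff p i) (coeff-neg p i)) (ℤP.+-inverseˡ (coeff p i)))

  ⊕-inverseʳ : ∀ p → (p ⊕ neg p) ≈ []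
  ⊕-inverseʳ p = ≈-trans (⊕-comm p (neg p)) (⊕-inverseˡ p)

  scale-cong : ∀ c {p q} → p ≈ q → scale c p ≈ scale c q
  scale-cong c {p} {q} e = coeffwise λ i →
    trans (coeff-scale c p i) (trans (cong (c *ℤ_) (at e i)) (sym (coeff-scale c q i)))

  scale-zero : ∀ p → scale 0ℤ p ≈ []
  scale-zero p = coeffwise λ i → trans (coeff-scale 0ℤ p i) (ℤP.*-zeroˡ (coeff p i))

  scale-one : ∀ p → scale 1ℤ p ≈ p
  scale-one p = coeffwise λ i → trans (coeff-scale 1ℤ p i) (ℤP.*-identityˡ _)

  0∷-⊗ : ∀ p q → ((0ℤ ∷ p) ⊗ q) ≈ (0ℤ ∷ (p ⊗ q))
  0∷-⊗ p q = ⊕-cong (scale-zero q) ≈-refl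

  ⊗-zeroʳ : ∀ p → (p ⊗ []) ≈ []
  ⊗-zeroʳ []      = ≈-refl
  ⊗-zeroʳ (a ∷ p) = 0∷-≈[] refl (⊗-zeroʳ p)

  ⊗-zeroˡ : ∀ {p} q → p ≈ [] → (p ⊗ q) ≈ []
  ⊗-zeroˡ {[]}    q e = ≈-refl
  ⊗-zeroˡ {a ∷ p} q e =
    ⊕-cong (≈-trans (≡⇒≈ (cong (λ c → scale c q) (at e 0))) (scale-zero q))
           (0∷-≈[] refl (⊗-zeroˡ {p} q (coeffwise (at e ∘ suc))))

  ⊗-congˡ : ∀ {p p′} q → p ≈ p′ → (p ⊗ q) ≈ (p′ ⊗ q)
  ⊗-congˡ {[]}    {p′}      q e = ≈-sym (⊗-zeroˡ q (≈-sym e))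
  ⊗-congˡ {a ∷ p} {[]}      q e = ⊗-zeroˡ q e
  ⊗-congˡ {a ∷ p} {a′ ∷ p′} q e =
    ⊕-cong (≡⇒≈ (cong (λ c → scale c q) (at e 0))) (∷-cong refl (⊗-congˡ {p} {p′} q (coeffwise (at e ∘ suc))))

  ⊗-congʳ : ∀ p {q q′} → q ≈ q′ → (p ⊗ q) ≈ (p ⊗ q′)
  ⊗-congʳ []      e = ≈-refl
  ⊗-congʳ (a ∷ p) e = ⊕-cong (scale-cong a e) (∷-cong refl (⊗-congʳ p e))

  ⊗-cong : ∀ {p p′ q q′} → p ≈ p′ → q ≈ q′ → (p ⊗ q) ≈ (p′ ⊗ q′)
  ⊗-cong {p′ = p′} {q = q} e f = ≈-trans (⊗-congˡ q e) (⊗-congʳ p′ f)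

  ⊗-distribʳ : ∀ p p′ q → ((p ⊕ p′) ⊗ q) ≈ ((p ⊗ q) ⊕ (p′ ⊗ q))
  ⊗-distribʳ []      p′       q = ≈-refl
  ⊗-distribʳ (a ∷ p) []       q = ≈-sym (⊕-identityʳ _)
  ⊗-distribʳ (a ∷ p) (b ∷ p′) q = coeffwise λ i → begin
    coeff (((a ∷ p) ⊕ (b ∷ p′)) ⊗ q) i                     ≡⟨ coeff-∷⊗ (a +ℤ b) (p ⊕ p′) q i ⟩
    (a +ℤ b) *ℤ coeff q i +ℤ coeff (0ℤ ∷ ((p ⊕ p′) ⊗ q)) i  ≡⟨ cong ((a +ℤ b) *ℤ coeff q i +ℤ_) (tail i) ⟩
    (a +ℤ b) *ℤ coeff q i +ℤ (x i +ℤ y i)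
      ≡⟨ solve 5 (λ a b c x y → (a :+ b) :* c :+ (x :+ y) := (a :* c :+ x) :+ (b :* c :+ y)) refl a b (coeff q i) (x i) (y i) ⟩
    (a *ℤ coeff q i +ℤ x i) +ℤ (b *ℤ coeff q i +ℤ y i)     ≡⟨ cong₂ _+ℤ_ (coeff-∷⊗ a p q i) (coeff-∷⊗ b p′ q i) ⟨
    coeff ((a ∷ p) ⊗ q) i +ℤ coeff ((b ∷ p′) ⊗ q) i        ≡⟨ coeff-⊕ ((a ∷ p) ⊗ q) ((b ∷ p′) ⊗ q) i ⟨
    coeff (((a ∷ p) ⊗ q) ⊕ ((b ∷ p′) ⊗ q)) i               ∎
    where
    open ≡-Reasoning
    open ℤSolver.+-*-Solver
    x y : ℕ → ℤ
    x = coeff (0ℤ ∷ (p ⊗ q))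
    y = coeff (0ℤ ∷ (p′ ⊗ q))
    tail : ∀ i → coeff (0ℤ ∷ ((p ⊕ p′) ⊗ q)) i ≡ x i +ℤ y i
    tail i = trans (at (∷-cong refl (⊗-distribʳ p p′ q)) i) (coeff-⊕ (0ℤ ∷ (p ⊗ q)) (0ℤ ∷ (p′ ⊗ q)) i)

  ⊗-∷ʳ : ∀ p b q → (p ⊗ (b ∷ q)) ≈ (scale b p ⊕ (0ℤ ∷ (p ⊗ q)))
  ⊗-∷ʳ []      b q = ≈-sym (0∷-≈[] refl ≈-refl)
  ⊗-∷ʳ (a ∷ p) b q = ∷-cong (cong (_+ℤ 0ℤ) (ℤP.*-comm a b)) (coeffwise λ i → begin
    coeff (scale a q ⊕ (p ⊗ (b ∷ q))) i                             ≡⟨ coeff-⊕ (scale a q) _ i ⟩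
    coeff (scale a q) i +ℤ coeff (p ⊗ (b ∷ q)) i                    ≡⟨ cong (coeff (scale a q) i +ℤ_) (at (⊗-∷ʳ p b q) i) ⟩
    coeff (scale a q) i +ℤ coeff (scale b p ⊕ (0ℤ ∷ (p ⊗ q))) i     ≡⟨ cong (coeff (scale a q) i +ℤ_) (coeff-⊕ (scale b p) _ i) ⟩
    coeff (scale a q) i +ℤ (coeff (scale b p) i +ℤ coeff (0ℤ ∷ (p ⊗ q)) i)
      ≡⟨ solve 3 (λ x y z → x :+ (y :+ z) := y :+ (x :+ z)) refl (coeff (scale a q) i) (coeff (scale b p) i) _ ⟩
    coeff (scale b p) i +ℤ (coeff (scale a q) i +ℤ coeff (0ℤ ∷ (p ⊗ q)) i)
      ≡⟨ cong (coeff (scale b p) i +ℤ_) (coeff-⊕ (scale a q) _ i) ⟨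
    coeff (scale b p) i +ℤ coeff (scale a q ⊕ (0ℤ ∷ (p ⊗ q))) i     ≡⟨ coeff-⊕ (scale b p) _ i ⟨
    coeff (scale b p ⊕ (scale a q ⊕ (0ℤ ∷ (p ⊗ q)))) i              ∎)
    where
    open ≡-Reasoning
    open ℤSolver.+-*-Solver

  ⊗-comm : ∀ p q → (p ⊗ q) ≈ (q ⊗ p)
  ⊗-comm []      q = ≈-sym (⊗-zeroʳ q)
  ⊗-comm (a ∷ p) q = ≈-trans (⊕-cong ≈-refl (∷-cong refl (⊗-comm p q))) (≈-sym (⊗-∷ʳ q a p))

  scale-⊗ : ∀ a q r → (scale a q ⊗ r) ≈ scale a (q ⊗ r)
  scale-⊗ a []      r = ≈-refl
  scale-⊗ a (b ∷ q) r = coeffwise λ i → begin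
    coeff ((a *ℤ b ∷ scale a q) ⊗ r) i                       ≡⟨ coeff-∷⊗ (a *ℤ b) (scale a q) r i ⟩
    a *ℤ b *ℤ coeff r i +ℤ coeff (0ℤ ∷ (scale a q ⊗ r)) i     ≡⟨ cong (a *ℤ b *ℤ coeff r i +ℤ_) (tail i) ⟩
    a *ℤ b *ℤ coeff r i +ℤ a *ℤ coeff (0ℤ ∷ (q ⊗ r)) i
      ≡⟨ solve 4 (λ a b c d → a :* b :* c :+ a :* d := a :* (b :* c :+ d)) refl a b (coeff r i) _ ⟩
    a *ℤ (b *ℤ coeff r i +ℤ coeff (0ℤ ∷ (q ⊗ r)) i)          ≡⟨ cong (a *ℤ_) (coeff-∷⊗ b q r i) ⟨
    a *ℤ coeff ((b ∷ q) ⊗ r) i                               ≡⟨ coeff-scale a ((b ∷ q) ⊗ r) i ⟨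
    coeff (scale a ((b ∷ q) ⊗ r)) i                          ∎
    where
    open ≡-Reasoning
    open ℤSolver.+-*-Solver
    tail : ∀ i → coeff (0ℤ ∷ (scale a q ⊗ r)) i ≡ a *ℤ coeff (0ℤ ∷ (q ⊗ r)) i
    tail zero    = sym (ℤP.*-zeroʳ a)
    tail (suc i) = trans (at (scale-⊗ a q r) i) (coeff-scale a (q ⊗ r) i)

  ⊗-assoc : ∀ p q r → ((p ⊗ q) ⊗ r) ≈ (p ⊗ (q ⊗ r))
  ⊗-assoc []      q r = ≈-refl
  ⊗-assoc (a ∷ p) q r =
    ≈-trans (⊗-distribʳ (scale a q) (0ℤ ∷ (p ⊗ q)) r)
            (⊕-cong (scale-⊗ a q r) (≈-trans (0∷-⊗ (p ⊗ q) r) (∷-cong refl (⊗-assoc p q r))))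

  ⊗-identityˡ : ∀ q → (one ⊗ q) ≈ q
  ⊗-identityˡ q = ≈-trans (⊕-cong (scale-one q) (0∷-≈[] refl ≈-refl)) (⊕-identityʳ q)

  ⊗-identityʳ : ∀ q → (q ⊗ one) ≈ q
  ⊗-identityʳ q = ≈-trans (⊗-comm q one) (⊗-identityˡ q)

  ⊗-distribˡ : ∀ p q q′ → (p ⊗ (q ⊕ q′)) ≈ ((p ⊗ q) ⊕ (p ⊗ q′))
  ⊗-distribˡ p q q′ =
    ≈-trans (⊗-comm p (q ⊕ q′)) (≈-trans (⊗-distribʳ q q′ p) (⊕-cong (⊗-comm q p) (⊗-comm q′ p)))

  ℤ[x] : CommutativeRing _ _
  ℤ[x] = record
    { Carrier = Poly ; _≈_ = _≈_ ; _+_ = _⊕_ ; _*_ = _⊗_ ; -_ = neg ; 0# = [] ; 1# = one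
    ; isCommutativeRing = record
      { isRing = record
        { +-isAbelianGroup = record
          { isGroup = record
            { isMonoid = record
              { isSemigroup = record
                { isMagma = record
                  { isEquivalence = record { refl = ≈-refl ; sym = ≈-sym ; trans = ≈-trans }
                  ; ∙-cong = ⊕-cong }
                ; assoc = ⊕-assoc }
              ; identity = ⊕-identityˡ , ⊕-identityʳ }
            ; inverse = ⊕-inverseˡ , ⊕-inverseʳ
            ; ⁻¹-cong = neg-cong }
          ; comm = ⊕-comm }
        ; *-cong = ⊗-cong
        ; *-assoc = ⊗-assoc
        ; *-identity = ⊗-identityˡ , ⊗-identityʳ
        ; distrib = ⊗-distribˡ , λ q p p′ → ⊗-distribʳ p p′ q }
      ; *-comm = ⊗-comm } }

  module ≈-Reasoning = SetoidReasoning (CommutativeRing.setoid ℤ[x])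

module ℤ-CoefficientSolver {c ℓ} (R : AlmostCommutativeRing c ℓ)
  (ι : +-*-rawRing -Raw-AlmostCommutative⟶ R) where

  open AlmostCommutativeRing R using () renaming (refl to R-refl)

  ≟-weak : WeaklyDecidable (Induced-equivalence ι)
  ≟-weak a b with a ℤ.≟ b
  ... | yes refl = just R-refl
  ... | no _     = nothing

  open import Algebra.Solver.Ring +-*-rawRing R ι ≟-weak public

module PolynomialSolver where

  open Polynomials

  const : ℤ → Poly
  const c = [ c ]

  const-* : ∀ a b → const (a *ℤ b) ≈ (const a ⊗ const b)
  const-* a b = ∷-cong (sym (ℤP.+-identityʳ (a *ℤ b))) ≈-refl

  const-neg : ∀ a → const (- a) ≈ neg (const a)
  const-neg a = ∷-cong (sym (ℤP.-1*i≡-i a)) ≈-refl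

  const-homomorphism : +-*-rawRing -Raw-AlmostCommutative⟶ fromCommutativeRing ℤ[x]
  const-homomorphism = record
    { ⟦_⟧    = const
    ; +-homo = λ _ _ → ≈-refl
    ; *-homo = const-*
    ; -‿homo = const-neg
    ; 0-homo = 0∷-≈[] refl ≈-refl
    ; 1-homo = ≈-refl
    }

  open ℤ-CoefficientSolver (fromCommutativeRing ℤ[x]) const-homomorphism public
    using (solve; _:=_; _:+_; _:*_; _:-_; :-_; con)

module LeadingTerms where

  open Polynomials

  DegBelow : Poly → ℕ → Set
  DegBelow p L = ∀ i → L ≤ i → coeff p i ≡ 0ℤ

  LeadingTerm : Poly → ℕ → ℤ → Set
  LeadingTerm p j c = coeff p j ≡ c × DegBelow p (suc j)

  Monic : Poly → Set
  Monic q = Σ ℕ λ e → LeadingTerm q e 1ℤ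

  DegBelow-length : ∀ p → DegBelow p (length p)
  DegBelow-length []      i       _       = refl
  DegBelow-length (a ∷ p) (suc i) (s≤s h) = DegBelow-length p i h

  DegBelow-mono : ∀ {p L L′} → L ≤ L′ → DegBelow p L → DegBelow p L′
  DegBelow-mono L≤L′ h i L′≤i = h i (ℕP.≤-trans L≤L′ L′≤i)

  DegBelow-resp-≈ : ∀ {p q L} → p ≈ q → DegBelow p L → DegBelow q L
  DegBelow-resp-≈ e h i le = trans (sym (at e i)) (h i le)

  DegBelow-scale : ∀ a {q L} → DegBelow q L → DegBelow (scale a q) L
  DegBelow-scale a {q} h i le = trans (coeff-scale a q i) (trans (cong (a *ℤ_) (h i le)) (ℤP.*-zeroʳ a))

  LeadingTerm-resp-≈ : ∀ {p q j c} → p ≈ q → LeadingTerm p j c → LeadingTerm q j c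
  LeadingTerm-resp-≈ e (top , deg) = trans (sym (at e _)) top , DegBelow-resp-≈ e deg

  LeadingTerm-scale : ∀ a {q e b} → LeadingTerm q e b → LeadingTerm (scale a q) e (a *ℤ b)
  LeadingTerm-scale a {q} (top , deg) = trans (coeff-scale a q _) (cong (a *ℤ_) top) , DegBelow-scale a {q} deg

  LeadingTerm-∷ : ∀ {a p j c} → LeadingTerm p j c → LeadingTerm (a ∷ p) (suc j) c
  LeadingTerm-∷ (top , deg) = top , λ { (suc i) (s≤s le) → deg i le }

  LeadingTerm-⊕ˡ : ∀ {p q j c} → DegBelow q j → LeadingTerm p j c → LeadingTerm (q ⊕ p) j c
  LeadingTerm-⊕ˡ {p} {q} {j} q-deg (top , deg) =
    trans (coeff-⊕ q p j) (trans (cong₂ _+ℤ_ (q-deg j ℕP.≤-refl) top) (ℤP.+-identityˡ _)) ,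
    λ i le → trans (coeff-⊕ q p i) (cong₂ _+ℤ_ (q-deg i (ℕP.<⇒≤ le)) (deg i le))

  LeadingTerm-⊗ : ∀ p {q j e c b} → LeadingTerm p j c → LeadingTerm q e b → LeadingTerm (p ⊗ q) (j + e) (c *ℤ b)
  LeadingTerm-⊗ [] {b = b} (top , _) _ = trans (sym (ℤP.*-zeroˡ b)) (cong (_*ℤ b) top) , λ _ _ → refl
  LeadingTerm-⊗ (a ∷ p) {q} {zero} {b = b} (top , deg) q-lead =
    LeadingTerm-resp-≈ (≈-sym (≈-trans (⊕-cong (≈-refl {scale a q}) (0∷-≈[] refl (⊗-zeroˡ q p≈[]))) (⊕-identityʳ _)))
                       (subst (LeadingTerm (scale a q) _) (cong (_*ℤ b) top) (LeadingTerm-scale a {q} q-lead))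
    where
    p≈[] : p ≈ []
    p≈[] = coeffwise λ i → deg (suc i) (s≤s z≤n)
  LeadingTerm-⊗ (a ∷ p) {q} {suc j} {e} (top , deg) q-lead@(_ , q-deg) =
    LeadingTerm-⊕ˡ {0ℤ ∷ (p ⊗ q)} {scale a q} (DegBelow-mono {scale a q} (s≤s (ℕP.m≤n+m e j)) (DegBelow-scale a {q} q-deg))
                   (LeadingTerm-∷ {0ℤ} {p ⊗ q} (LeadingTerm-⊗ p {q} (top , λ i le → deg (suc i) (s≤s le)) q-lead))

  LeadingTerm-unique : ∀ {p j j′ c c′} → c ≢ 0ℤ → c′ ≢ 0ℤ → LeadingTerm p j c → LeadingTerm p j′ c′ → j ≡ j′
  LeadingTerm-unique {j = j} {j′} c≢0 c′≢0 (top , deg) (top′ , deg′) with ℕP.<-cmp j j′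
  ... | tri< j<j′ _ _ = ⊥-elim (c′≢0 (trans (sym top′) (deg j′ j<j′)))
  ... | tri≈ _ j≡j′ _ = j≡j′
  ... | tri> _ _ j′<j = ⊥-elim (c≢0 (trans (sym top) (deg′ j j′<j)))

  LeadingTerm-∷ʳ : ∀ xs c → LeadingTerm (xs ++ [ c ]) (length xs) c
  LeadingTerm-∷ʳ []       c = refl , λ { (suc i) _ → refl }
  LeadingTerm-∷ʳ (x ∷ xs) c = LeadingTerm-∷ (LeadingTerm-∷ʳ xs c)

  LeadingTerm-monomial : ∀ k c → LeadingTerm (shift k [ c ]) k c
  LeadingTerm-monomial k c = subst (λ j → LeadingTerm (shift k [ c ]) j c) (length-replicate k) (LeadingTerm-∷ʳ (replicate k 0ℤ) c)

  ≈[]⊎LeadingTerm : ∀ p → p ≈ [] ⊎ Σ ℕ λ j → Σ ℤ λ c → c ≢ 0ℤ × LeadingTerm p j c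
  ≈[]⊎LeadingTerm []      = inj₁ ≈-refl
  ≈[]⊎LeadingTerm (a ∷ p) with ≈[]⊎LeadingTerm p
  ... | inj₂ (j , c , c≢0 , lead) = inj₂ (suc j , c , c≢0 , LeadingTerm-∷ lead)
  ... | inj₁ p≈[] with a ℤ.≟ 0ℤ
  ...   | yes a≡0 = inj₁ (0∷-≈[] a≡0 p≈[])
  ...   | no a≢0  = inj₂ (0 , a , a≢0 , refl , λ { (suc i) _ → at p≈[] i })

  Monic-resp-≈ : ∀ {p q} → p ≈ q → Monic p → Monic q
  Monic-resp-≈ p≈q (e , lead) = e , LeadingTerm-resp-≈ p≈q lead

  Monic-⊗ : ∀ p q → Monic p → Monic q → Monic (p ⊗ q)
  Monic-⊗ p q (j , p-lead) (e , q-lead) = j + e , LeadingTerm-⊗ p p-lead q-lead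

  Monic-one : Monic one
  Monic-one = 0 , refl , λ { (suc i) _ → refl }

  Monic-cancelʳ : ∀ p {q} → Monic q → Monic (p ⊗ q) → Monic p
  Monic-cancelʳ p {q} (e , q-lead) (n , pq-lead) with ≈[]⊎LeadingTerm p
  ... | inj₁ p≈[] = ⊥-elim (case trans (sym (proj₁ pq-lead)) (at (⊗-zeroˡ q p≈[]) n) of λ ())
  ... | inj₂ (j , c , c≢0 , p-lead) = j , subst (LeadingTerm p j) c≡1 p-lead
    where
    pq-lead′ : LeadingTerm (p ⊗ q) (j + e) (c *ℤ 1ℤ)
    pq-lead′ = LeadingTerm-⊗ p p-lead q-lead
    j+e≡n : j + e ≡ n
    j+e≡n = LeadingTerm-unique {p ⊗ q} (λ c*1≡0 → c≢0 (trans (sym (ℤP.*-identityʳ c)) c*1≡0)) (λ ()) pq-lead′ pq-lead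
    c≡1 : c ≡ 1ℤ
    c≡1 = trans (sym (ℤP.*-identityʳ c)) (trans (sym (proj₁ pq-lead′)) (trans (cong (coeff (p ⊗ q)) j+e≡n) (proj₁ pq-lead)))

module Stripping where

  open Polynomials
  open LeadingTerms

  private
    dropZeros-view : ∀ r → (dropZeros r ≡ [] × All (_≡ 0ℤ) r) ⊎
      Σ ℤ λ c → Σ (List ℤ) λ rest → Σ ℕ λ k → c ≢ 0ℤ × dropZeros r ≡ c ∷ rest × r ≡ replicate k 0ℤ ++ c ∷ rest
    dropZeros-view []      = inj₁ (refl , [])
    dropZeros-view (a ∷ r) with a ℤ.≟ 0ℤ
    ... | no a≢0   = inj₂ (a , r , 0 , a≢0 , refl , refl)
    ... | yes refl with dropZeros-view r
    ...   | inj₁ (dz≡[] , zeros) = inj₁ (dz≡[] , refl ∷ zeros)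
    ...   | inj₂ (c , rest , k , c≢0 , dz≡ , r≡) = inj₂ (c , rest , suc k , c≢0 , dz≡ , cong (0ℤ ∷_) r≡)

    All-reverse : ∀ {P : ℤ → Set} xs → All P xs → All P (reverse xs)
    All-reverse []       []         = []
    All-reverse (x ∷ xs) (px ∷ pxs) =
      subst (All _) (sym (unfold-reverse x xs)) (AllP.++⁺ (All-reverse xs pxs) (px ∷ []))

    zeros≈[] : ∀ {zs} → All (_≡ 0ℤ) zs → zs ≈ []
    zeros≈[] []           = ≈-refl
    zeros≈[] (z≡0 ∷ zeros) = 0∷-≈[] z≡0 (zeros≈[] zeros)

    ++-zeros : ∀ ys {zs} → All (_≡ 0ℤ) zs → (ys ++ zs) ≈ ys
    ++-zeros []       zeros = zeros≈[] zeros
    ++-zeros (y ∷ ys) zeros = ∷-cong refl (++-zeros ys zeros)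

  StripView : Poly → Set
  StripView p = (strip p ≡ [] × p ≈ []) ⊎
    Σ (List ℤ) λ xs → Σ ℤ λ c → c ≢ 0ℤ × strip p ≡ xs ++ [ c ] × p ≈ xs ++ [ c ]

  strip-view : ∀ p → StripView p
  strip-view p with dropZeros-view (reverse p)
  ... | inj₁ (dz≡[] , zeros) = inj₁ (cong reverse dz≡[] ,
          ≈-trans (≡⇒≈ (sym (reverse-involutive p))) (zeros≈[] (All-reverse (reverse p) zeros)))
  ... | inj₂ (c , rest , k , c≢0 , dz≡ , rev≡) =
          inj₂ (reverse rest , c , c≢0 , trans (cong reverse dz≡) (unfold-reverse c rest) , p≈)
    where
    p≡ : p ≡ (reverse rest ++ [ c ]) ++ reverse (replicate k 0ℤ)
    p≡ = trans (sym (reverse-involutive p)) (trans (cong reverse rev≡)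
           (trans (reverse-++ (replicate k 0ℤ) (c ∷ rest)) (cong (_++ reverse (replicate k 0ℤ)) (unfold-reverse c rest))))
    p≈ : p ≈ reverse rest ++ [ c ]
    p≈ = ≈-trans (≡⇒≈ p≡) (++-zeros (reverse rest ++ [ c ]) (All-reverse (replicate k 0ℤ) (AllP.replicate⁺ k refl)))

  strip-≈ : ∀ p → strip p ≈ p
  strip-≈ p with strip-view p
  ... | inj₁ (strip≡ , p≈) = ≈-trans (≡⇒≈ strip≡) (≈-sym p≈)
  ... | inj₂ (_ , _ , _ , strip≡ , p≈) = ≈-trans (≡⇒≈ strip≡) (≈-sym p≈)

  strip-≈[] : ∀ p → p ≈ [] → strip p ≡ []
  strip-≈[] p p≈[] with strip-view p
  ... | inj₁ (strip≡[] , _) = strip≡[]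
  ... | inj₂ (xs , c , c≢0 , _ , p≈) =
    ⊥-elim (c≢0 (trans (sym (proj₁ (LeadingTerm-∷ʳ xs c))) (trans (sym (at p≈ (length xs))) (at p≈[] (length xs)))))

  strip-∷ʳ : ∀ xs c → c ≢ 0ℤ → strip (xs ++ [ c ]) ≡ xs ++ [ c ]
  strip-∷ʳ xs c c≢0 = begin
    reverse (dropZeros (reverse (xs ++ [ c ])))  ≡⟨ cong (reverse ∘ dropZeros) (reverse-++ xs [ c ]) ⟩
    reverse (dropZeros (c ∷ reverse xs))         ≡⟨ cong reverse (dropZeros-nonzero c≢0) ⟩
    reverse (c ∷ reverse xs)                     ≡⟨ unfold-reverse c (reverse xs) ⟩
    reverse (reverse xs) ++ [ c ]                ≡⟨ cong (_++ [ c ]) (reverse-involutive xs) ⟩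
    xs ++ [ c ]                                  ∎
    where
    open ≡-Reasoning
    dropZeros-nonzero : ∀ {r} → c ≢ 0ℤ → dropZeros (c ∷ r) ≡ c ∷ r
    dropZeros-nonzero c≢0 with c ℤ.≟ 0ℤ
    ... | yes c≡0 = ⊥-elim (c≢0 c≡0)
    ... | no _    = refl

  leading-∷ʳ : ∀ xs c → c ≢ 0ℤ → leading (xs ++ [ c ]) ≡ c
  leading-∷ʳ xs c c≢0 = leading-of {xs ++ [ c ]} (trans (cong reverse (strip-∷ʳ xs c c≢0)) (reverse-++ xs [ c ]))
    where
    leading-of : ∀ {p r} → reverse (strip p) ≡ c ∷ r → leading p ≡ c
    leading-of {p} eq with reverse (strip p) | eq
    ... | _ | refl = refl

  length-∷ʳ : ∀ (xs : List ℤ) c → length (xs ++ [ c ]) ≡ suc (length xs)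
  length-∷ʳ xs c = trans (length-++ xs) (ℕP.+-comm (length xs) 1)

  length-strip : ∀ {p L} → DegBelow p L → length (strip p) ≤ L
  length-strip {p} {L} deg with strip-view p
  ... | inj₁ (strip≡[] , _) rewrite strip≡[] = z≤n
  ... | inj₂ (xs , c , c≢0 , strip≡ , p≈) rewrite strip≡ | length-∷ʳ xs c = ℕP.≰⇒> L≰
    where
    L≰ : ¬ (L ≤ length xs)
    L≰ L≤ = c≢0 (trans (sym (proj₁ (LeadingTerm-∷ʳ xs c))) (trans (sym (at p≈ (length xs))) (deg (length xs) L≤)))

  length-strip-LeadingTerm : ∀ {q e c} → c ≢ 0ℤ → LeadingTerm q e c → length (strip q) ≡ suc e
  length-strip-LeadingTerm {q} c≢0 q-lead with strip-view q
  ... | inj₁ (_ , q≈[]) = ⊥-elim (c≢0 (trans (sym (proj₁ q-lead)) (at q≈[] _)))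
  ... | inj₂ (xs , c′ , c′≢0 , strip≡ , q≈) =
    trans (cong length strip≡) (trans (length-∷ʳ xs c′)
      (cong suc (LeadingTerm-unique {q} c′≢0 c≢0 (LeadingTerm-resp-≈ {xs ++ [ c′ ]} {q} (≈-sym q≈) (LeadingTerm-∷ʳ xs c′)) q-lead)))

module LongDivision where

  open Polynomials
  open PolynomialSolver
  open LeadingTerms
  open Stripping

  IsQuotRem : Poly → Poly → ℕ → QR → Set
  IsQuotRem p q e (quo , rem) = p ≈ (quo ⊗ q) ⊕ rem × DegBelow rem e

  DegBelow-cancel : ∀ {p r j c} → LeadingTerm p j c → LeadingTerm r j c → DegBelow (p ⊕ neg r) j
  DegBelow-cancel {p} {r} {j} (top , deg) (top′ , deg′) i j≤i =
    trans (coeff-⊕ p (neg r) i) (trans (cong₂ _+ℤ_ (same i j≤i) (coeff-neg r i)) (ℤP.+-inverseʳ (coeff r i)))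
    where
    same : ∀ i → j ≤ i → coeff p i ≡ coeff r i
    same i j≤i with ℕP.m≤n⇒m<n∨m≡n j≤i
    ... | inj₁ j<i  = trans (deg i j<i) (sym (deg′ i j<i))
    ... | inj₂ refl = trans top (sym top′)

  long-division-step : ∀ {p q} k e c → LeadingTerm p (k + e) c → LeadingTerm q e 1ℤ →
    DegBelow (p ⊕ neg (shift k [ c ] ⊗ q)) (k + e)
  long-division-step {p} {q} k e c p-lead q-lead = DegBelow-cancel {p} {shift k [ c ] ⊗ q} p-lead
    (subst (LeadingTerm (shift k [ c ] ⊗ q) (k + e)) (ℤP.*-identityʳ c)
           (LeadingTerm-⊗ (shift k [ c ]) (LeadingTerm-monomial k c) q-lead))

  private
    shorter-than : ∀ {p q e} → LeadingTerm q e 1ℤ →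
      (length (strip p) ℕ.<ᵇ length (strip q)) ≡ true → length (strip p) ≤ e
    shorter-than {p} {q} q-lead lt =
      ℕP.≤-pred (subst (length (strip p) <_) (length-strip-LeadingTerm {q} (λ ()) q-lead)
                       (ℕP.<ᵇ⇒< (length (strip p)) (length (strip q)) (subst IsTrue (sym lt) tt)))

    step-length : ∀ {q} xs c e f → LeadingTerm q e 1ℤ → e ≤ length xs → length xs ≤ f + e →
      length (strip ((xs ++ [ c ]) ⊕ neg (shift (length xs ∸ e) [ c ] ⊗ q))) ≤ f + e
    step-length {q} xs c e f q-lead e≤n n≤f+e =
      ℕP.≤-trans (length-strip {(xs ++ [ c ]) ⊕ neg (shift k [ c ] ⊗ q)} (long-division-step {xs ++ [ c ]} {q} k e c xs-lead q-lead))
                 (subst (_≤ f + e) n≡k+e n≤f+e)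
      where
      k = length xs ∸ e
      n≡k+e : length xs ≡ k + e
      n≡k+e = sym (ℕP.m∸n+n≡m e≤n)
      xs-lead : LeadingTerm (xs ++ [ c ]) (k + e) c
      xs-lead = subst (λ j → LeadingTerm (xs ++ [ c ]) j c) n≡k+e (LeadingTerm-∷ʳ xs c)

    shortened : ∀ {p q e} f → LeadingTerm q e 1ℤ → length (strip p) ≤ suc f + e →
      (length (strip p) ℕ.<ᵇ length (strip q)) ≡ false →
      length (strip (strip p ⊕ neg (shift (length (strip p) ∸ length (strip q)) [ leading (strip p) ] ⊗ strip q)))
        ≤ f + e
    shortened {p} {q} {e} f q-lead bound not-lt with strip-view p
    ... | inj₁ (strip≡[] , _) = ⊥-elim (subst IsTrue not-lt (ℕP.<⇒<ᵇ nonempty))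
      where
      nonempty : length (strip p) < length (strip q)
      nonempty = subst₂ _<_ (cong length (sym strip≡[])) (sym (length-strip-LeadingTerm {q} (λ ()) q-lead)) (s≤s z≤n)
    ... | inj₂ (xs , c , c≢0 , strip≡ , _) =
      subst (λ P → Goal P k′ (leading (strip p))) (sym strip≡)
        (subst₂ (Goal (xs ++ [ c ])) (sym k≡) (sym c≡)
          (step-length xs c e f (LeadingTerm-resp-≈ {q} (≈-sym (strip-≈ q)) q-lead) e≤n (ℕP.≤-pred len-bound)))
      where
      Goal : Poly → ℕ → ℤ → Set
      Goal P k a = length (strip (P ⊕ neg (shift k [ a ] ⊗ strip q))) ≤ f + e
      k′ = length (strip p) ∸ length (strip q)
      len≡ : length (strip p) ≡ suc (length xs)
      len≡ = trans (cong length strip≡) (length-∷ʳ xs c)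
      len-bound : suc (length xs) ≤ suc f + e
      len-bound = subst (_≤ suc f + e) len≡ bound
      k≡ : k′ ≡ length xs ∸ e
      k≡ = cong₂ _∸_ len≡ (length-strip-LeadingTerm {q} (λ ()) q-lead)
      c≡ : leading (strip p) ≡ c
      c≡ = trans (cong leading strip≡) (leading-∷ʳ xs c c≢0)
      e≤n : e ≤ length xs
      e≤n = ℕP.≤-pred (subst₂ _≤_ (length-strip-LeadingTerm {q} (λ ()) q-lead) len≡
                        (ℕP.≮⇒≥ λ lt → subst IsTrue not-lt (ℕP.<⇒<ᵇ lt)))

    step-correct : ∀ {p q t r e} → IsQuotRem (strip p ⊕ neg (t ⊗ strip q)) (strip q) e r →
      IsQuotRem p q e ((t ⊕ QR.quo r) , QR.rem r)
    step-correct {p} {q} {t} {quo , rem} (p′≈ , rem-deg) = p≈ , rem-deg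
      where
      p≈ : p ≈ (t ⊕ quo) ⊗ q ⊕ rem
      p≈ = ≈-trans (≈-sym (strip-≈ p))
           (≈-trans (solve 2 (λ P T → P := T :+ (P :- T)) ≈-refl (strip p) (t ⊗ strip q))
           (≈-trans (⊕-cong (≈-refl {t ⊗ strip q}) p′≈)
           (≈-trans (solve 4 (λ T Q B R → T :* B :+ (Q :* B :+ R) := (T :+ Q) :* B :+ R) ≈-refl t quo (strip q) rem)
                    (⊕-cong (⊗-congʳ (t ⊕ quo) (strip-≈ q)) (≈-refl {rem})))))

  divMonic-correct : ∀ fuel p q e → LeadingTerm q e 1ℤ → length (strip p) ≤ fuel + e →
    IsQuotRem p q e (divMonic fuel p q)
  divMonic-correct zero p q e _ bound =
    ≈-sym (strip-≈ p) , λ i le → DegBelow-length (strip p) i (ℕP.≤-trans bound le)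
  divMonic-correct (suc f) p q e q-lead bound with length (strip p) ℕ.<ᵇ length (strip q) in lt?
  ... | true  = ≈-sym (strip-≈ p) ,
                λ i le → DegBelow-length (strip p) i (ℕP.≤-trans (shorter-than {p} {q} q-lead lt?) le)
  ... | false = step-correct {p} {q} {t} {divMonic f p′ (strip q)}
    (divMonic-correct f p′ (strip q) e (LeadingTerm-resp-≈ {q} (≈-sym (strip-≈ q)) q-lead)
                      (shortened {p} {q} f q-lead bound lt?))
    where
    t = shift (length (strip p) ∸ length (strip q)) [ leading (strip p) ]
    p′ = strip p ⊕ neg (t ⊗ strip q)

module Divisibility where

  open Polynomials
  open PolynomialSolver
  open LeadingTerms
  open Stripping
  open LongDivision

  infix 4 _∣ₚ_
  _∣ₚ_ : Poly → Poly → Set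
  q ∣ₚ p = Σ Poly λ s → p ≈ s ⊗ q

  infix 4 _∈⟨_,_⟩
  _∈⟨_,_⟩ : Poly → Poly → Poly → Set
  c ∈⟨ A , B ⟩ = Σ Poly λ U → Σ Poly λ V → (U ⊗ A) ⊕ (V ⊗ B) ≈ c

  CoprimeOverℚ : Poly → Poly → Set
  CoprimeOverℚ A B = Σ ℤ λ k → k ≢ 0ℤ × const k ∈⟨ A , B ⟩

  ∣ₚ-refl : ∀ a → a ∣ₚ a
  ∣ₚ-refl a = one , ≈-sym (⊗-identityˡ a)

  one∣ₚ : ∀ p → one ∣ₚ p
  one∣ₚ p = p , ≈-sym (⊗-identityʳ p)

  ∣ₚ-[] : ∀ a → a ∣ₚ []
  ∣ₚ-[] a = [] , ≈-refl

  ∣ₚ-respʳ : ∀ {q p p′} → p ≈ p′ → q ∣ₚ p → q ∣ₚ p′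
  ∣ₚ-respʳ p≈p′ (s , p≈) = s , ≈-trans (≈-sym p≈p′) p≈

  ∣ₚ-respˡ : ∀ {q q′ p} → q ≈ q′ → q ∣ₚ p → q′ ∣ₚ p
  ∣ₚ-respˡ q≈q′ (s , p≈) = s , ≈-trans p≈ (⊗-congʳ s q≈q′)

  ∣ₚ-trans : ∀ {a b c} → a ∣ₚ b → b ∣ₚ c → a ∣ₚ c
  ∣ₚ-trans {a} (s , b≈) (t , c≈) = t ⊗ s , ≈-trans c≈ (≈-trans (⊗-congʳ t b≈) (≈-sym (⊗-assoc t s a)))

  ∣ₚ-⊗ : ∀ a b → a ∣ₚ b ⊗ a
  ∣ₚ-⊗ a b = b , ≈-refl

  ∣ₚ-⊗ˡ : ∀ {a b} c → a ∣ₚ b → a ∣ₚ c ⊗ b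
  ∣ₚ-⊗ˡ {a} c (s , b≈) = c ⊗ s , ≈-trans (⊗-congʳ c b≈) (≈-sym (⊗-assoc c s a))

  ⊗-monoˡ-∣ₚ : ∀ {a b} c → a ∣ₚ b → c ⊗ a ∣ₚ c ⊗ b
  ⊗-monoˡ-∣ₚ {a} c (s , b≈) =
    s , ≈-trans (⊗-congʳ c b≈) (solve 3 (λ c s a → c :* (s :* a) := s :* (c :* a)) ≈-refl c s a)

  ∣ₚ-⊕ : ∀ {a b c} → a ∣ₚ b → a ∣ₚ c → a ∣ₚ b ⊕ c
  ∣ₚ-⊕ {a} (s , b≈) (t , c≈) = s ⊕ t , ≈-trans (⊕-cong b≈ c≈) (≈-sym (⊗-distribʳ s t a))

  ∣ₚ-neg : ∀ {a b} → a ∣ₚ b → a ∣ₚ neg b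
  ∣ₚ-neg {a} (s , b≈) = neg s , ≈-trans (neg-cong b≈) (solve 2 (λ s a → :- (s :* a) := (:- s) :* a) ≈-refl s a)

  deg<monic⇒≈[] : ∀ {q e} w → LeadingTerm q e 1ℤ → DegBelow (w ⊗ q) e → w ≈ []
  deg<monic⇒≈[] {q} {e} w q-lead deg with ≈[]⊎LeadingTerm w
  ... | inj₁ w≈[] = w≈[]
  ... | inj₂ (j , c , c≢0 , w-lead) =
    ⊥-elim (c≢0 (trans (sym (ℤP.*-identityʳ c)) (trans (sym (proj₁ (LeadingTerm-⊗ w w-lead q-lead))) (deg (j + e) (ℕP.m≤n+m e j)))))

  divMonic-exact : ∀ p {q e} → LeadingTerm q e 1ℤ → IsQuotRem p q e (divMonic (length p) p q)
  divMonic-exact p {q} {e} q-lead =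
    divMonic-correct (length p) p q e q-lead (ℕP.≤-trans (length-strip {p} (DegBelow-length p)) (ℕP.m≤m+n (length p) e))

  ∣ₚ⇒rem≈[] : ∀ p q → Monic q → q ∣ₚ p → QR.rem (divMonic (length p) p q) ≈ []
  ∣ₚ⇒rem≈[] p q (e , q-lead) (s , p≈) = ≈-trans rem≈ (⊗-zeroˡ q (deg<monic⇒≈[] (s ⊕ neg quo) q-lead rem-deg))
    where
    quo = QR.quo (divMonic (length p) p q)
    rem = QR.rem (divMonic (length p) p q)
    division = divMonic-exact p q-lead
    rem≈ : rem ≈ (s ⊕ neg quo) ⊗ q
    rem≈ = ≈-trans (solve 3 (λ R Q B → R := (Q :* B :+ R) :- Q :* B) ≈-refl rem quo q)
           (≈-trans (⊕-cong (≈-trans (≈-sym (proj₁ division)) p≈) (≈-refl {neg (quo ⊗ q)}))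
                    (solve 3 (λ S Q B → S :* B :- Q :* B := (S :- Q) :* B) ≈-refl s quo q))
    rem-deg : DegBelow ((s ⊕ neg quo) ⊗ q) e
    rem-deg = DegBelow-resp-≈ {rem} rem≈ (proj₂ division)

  ∣ₚ⇒quotM-exact : ∀ p q → Monic q → q ∣ₚ p → quotM p q ⊗ q ≈ p
  ∣ₚ⇒quotM-exact p q q-monic@(e , q-lead) q∣p = ≈-sym (≈-trans (proj₁ (divMonic-exact p q-lead))
    (≈-trans (⊕-cong (≈-refl {quotM p q ⊗ q}) (∣ₚ⇒rem≈[] p q q-monic q∣p)) (⊕-identityʳ _)))

  ⊗-cancelʳ-monic : ∀ {a b} q → Monic q → a ⊗ q ≈ b ⊗ q → a ≈ b
  ⊗-cancelʳ-monic {a} {b} q (e , q-lead) a⊗q≈b⊗q =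
    ≈-trans (solve 2 (λ A B → A := (A :- B) :+ B) ≈-refl a b) (⊕-cong a-b≈[] (≈-refl {b}))
    where
    diff≈[] : (a ⊕ neg b) ⊗ q ≈ []
    diff≈[] = ≈-trans (solve 3 (λ A B Q → (A :- B) :* Q := A :* Q :- B :* Q) ≈-refl a b q)
              (≈-trans (⊕-cong a⊗q≈b⊗q (≈-refl {neg (b ⊗ q)})) (⊕-inverseʳ (b ⊗ q)))
    a-b≈[] : a ⊕ neg b ≈ []
    a-b≈[] = deg<monic⇒≈[] (a ⊕ neg b) q-lead (λ i _ → at diff≈[] i)

  const-⊗ : ∀ k r → const k ⊗ r ≈ scale k r
  const-⊗ k r = ≈-trans (⊕-cong (≈-refl {scale k r}) (0∷-≈[] refl ≈-refl)) (⊕-identityʳ _)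

  ∣ₚ-const⊗⇒∣ₚ : ∀ {G} q k → Monic q → k ≢ 0ℤ → q ∣ₚ const k ⊗ G → q ∣ₚ G
  ∣ₚ-const⊗⇒∣ₚ {G} q k (e , q-lead) k≢0 (s , kG≈) =
    quo , ≈-trans (proj₁ division) (≈-trans (⊕-cong (≈-refl {quo ⊗ q}) rem≈[]) (⊕-identityʳ _))
    where
    division = divMonic-exact G q-lead
    quo = QR.quo (divMonic (length G) G q)
    rem = QR.rem (divMonic (length G) G q)
    w = s ⊕ neg (const k ⊗ quo)
    k·rem≈ : const k ⊗ rem ≈ w ⊗ q
    k·rem≈ = ≈-trans (solve 4 (λ K R Q B → K :* R := K :* ((Q :* B :+ R) :- Q :* B)) ≈-refl (const k) rem quo q)
             (≈-trans (⊗-congʳ (const k) (⊕-cong (≈-sym (proj₁ division)) (≈-refl {neg (quo ⊗ q)})))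
             (≈-trans (solve 4 (λ K G Q B → K :* (G :- Q :* B) := K :* G :- K :* Q :* B) ≈-refl (const k) G quo q)
             (≈-trans (⊕-cong kG≈ (≈-refl {neg ((const k ⊗ quo) ⊗ q)}))
                      (solve 4 (λ K S Q B → S :* B :- K :* Q :* B := (S :- K :* Q) :* B) ≈-refl (const k) s quo q))))
    coeff-k·rem : ∀ i → coeff (const k ⊗ rem) i ≡ k *ℤ coeff rem i
    coeff-k·rem i = trans (at (const-⊗ k rem) i) (coeff-scale k rem i)
    k·rem≈[] : const k ⊗ rem ≈ []
    k·rem≈[] = ≈-trans k·rem≈ (⊗-zeroˡ q (deg<monic⇒≈[] w q-lead (DegBelow-resp-≈ {const k ⊗ rem} k·rem≈
                 λ i le → trans (coeff-k·rem i) (trans (cong (k *ℤ_) (proj₂ division i le)) (ℤP.*-zeroʳ k)))))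
    rem≈[] : rem ≈ []
    rem≈[] = coeffwise λ i → case ℤP.i*j≡0⇒i≡0∨j≡0 k (trans (sym (coeff-k·rem i)) (at k·rem≈[] i)) of λ where
      (inj₁ k≡0)  → ⊥-elim (k≢0 k≡0)
      (inj₂ r≡0)  → r≡0

  ∈⟨⟩-swap : ∀ {A B c} → c ∈⟨ A , B ⟩ → c ∈⟨ B , A ⟩
  ∈⟨⟩-swap {A} {B} (U , V , comb) = V , U , ≈-trans (⊕-comm (V ⊗ B) (U ⊗ A)) comb

  ∈⟨⟩-∣ₚ : ∀ {A A′ B B′ x} → x ∈⟨ A′ , B′ ⟩ → A ∣ₚ A′ → B ∣ₚ B′ → x ∈⟨ A , B ⟩
  ∈⟨⟩-∣ₚ {A} {A′} {B} {B′} (U , V , comb) (s , A′≈) (t , B′≈) = U ⊗ s , V ⊗ t ,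
    ≈-trans (⊕-cong (⊗-assoc U s A) (⊗-assoc V t B))
            (≈-trans (⊕-cong (⊗-congʳ U (≈-sym A′≈)) (⊗-congʳ V (≈-sym B′≈))) comb)

  ∈⟨⟩-absorb : ∀ {A B G c} → c ∈⟨ A , G ⟩ → G ∈⟨ A , B ⟩ → c ∈⟨ A , B ⟩
  ∈⟨⟩-absorb {A} {B} {G} (U₁ , V₁ , comb₁) (U , V , comb) = U₁ ⊕ V₁ ⊗ U , V₁ ⊗ V ,
    ≈-trans (solve 6 (λ U₁ V₁ U V A B → (U₁ :+ V₁ :* U) :* A :+ V₁ :* V :* B := U₁ :* A :+ V₁ :* (U :* A :+ V :* B))
                     ≈-refl U₁ V₁ U V A B)
            (≈-trans (⊕-cong (≈-refl {U₁ ⊗ A}) (⊗-congʳ V₁ comb)) comb₁)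

  ∈⟨⟩-⊗ : ∀ {A B C x y} → x ∈⟨ A , B ⟩ → y ∈⟨ A , C ⟩ → x ⊗ y ∈⟨ A , B ⊗ C ⟩
  ∈⟨⟩-⊗ {A} {B} {C} (U₁ , V₁ , comb₁) (U₂ , V₂ , comb₂) =
    U₁ ⊗ U₂ ⊗ A ⊕ U₁ ⊗ V₂ ⊗ C ⊕ V₁ ⊗ B ⊗ U₂ , V₁ ⊗ V₂ ,
    ≈-trans (solve 7 (λ U₁ V₁ U₂ V₂ A B C →
               (U₁ :* U₂ :* A :+ U₁ :* V₂ :* C :+ V₁ :* B :* U₂) :* A :+ V₁ :* V₂ :* (B :* C)
               := (U₁ :* A :+ V₁ :* B) :* (U₂ :* A :+ V₂ :* C)) ≈-refl U₁ V₁ U₂ V₂ A B C)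
            (⊗-cong comb₁ comb₂)

  ∣ₚ-⊗-∈⟨⟩ : ∀ {A B G x} → x ∈⟨ A , B ⟩ → A ∣ₚ B ⊗ G → A ∣ₚ x ⊗ G
  ∣ₚ-⊗-∈⟨⟩ {A} {B} {G} {x} (U , V , comb) (s , BG≈) =
    ∣ₚ-respʳ xG≈ (∣ₚ-⊕ (∣ₚ-⊗ A (U ⊗ G)) (∣ₚ-⊗ˡ V (s , BG≈)))
    where
    xG≈ : (U ⊗ G) ⊗ A ⊕ V ⊗ (B ⊗ G) ≈ x ⊗ G
    xG≈ = ≈-trans (solve 5 (λ U V A B G → U :* G :* A :+ V :* (B :* G) := (U :* A :+ V :* B) :* G) ≈-refl U V A B G)
                  (⊗-congˡ G comb)

  CoprimeOverℚ-swap : ∀ {A B} → CoprimeOverℚ A B → CoprimeOverℚ B A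
  CoprimeOverℚ-swap (k , k≢0 , comb) = k , k≢0 , ∈⟨⟩-swap comb

  CoprimeOverℚ-absorb : ∀ {A B G} → CoprimeOverℚ A G → G ∈⟨ A , B ⟩ → CoprimeOverℚ A B
  CoprimeOverℚ-absorb (k , k≢0 , k∈) G∈ = k , k≢0 , ∈⟨⟩-absorb k∈ G∈

  CoprimeOverℚ-prodP : ∀ {A} Bs → All (CoprimeOverℚ A) Bs → CoprimeOverℚ A (prodP Bs)
  CoprimeOverℚ-prodP []       []                            = 1ℤ , (λ ()) , [] , one , ≈-refl
  CoprimeOverℚ-prodP (B ∷ Bs) ((k , k≢0 , comb) ∷ coprimes) with CoprimeOverℚ-prodP Bs coprimes
  ... | l , l≢0 , comb′ = k *ℤ l , k*l≢0 , ∈⟨⟩-resp (≈-sym (const-* k l)) (∈⟨⟩-⊗ comb comb′)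
    where
    k*l≢0 : k *ℤ l ≢ 0ℤ
    k*l≢0 kl≡0 = case ℤP.i*j≡0⇒i≡0∨j≡0 k kl≡0 of λ where
      (inj₁ k≡0) → k≢0 k≡0
      (inj₂ l≡0) → l≢0 l≡0
    ∈⟨⟩-resp : ∀ {A B x y} → x ≈ y → x ∈⟨ A , B ⟩ → y ∈⟨ A , B ⟩
    ∈⟨⟩-resp x≈y (U , V , comb) = U , V , ≈-trans comb x≈y

  coprime-∣ₚ⊗⇒∣ₚ : ∀ {A B G} → Monic A → CoprimeOverℚ A B → A ∣ₚ B ⊗ G → A ∣ₚ G
  coprime-∣ₚ⊗⇒∣ₚ {A} A-monic (k , k≢0 , comb) A∣BG = ∣ₚ-const⊗⇒∣ₚ A k A-monic k≢0 (∣ₚ-⊗-∈⟨⟩ comb A∣BG)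

  coprime-∣ₚ⇒⊗-∣ₚ : ∀ {A B C} → Monic A → CoprimeOverℚ A B → A ∣ₚ C → B ∣ₚ C → A ⊗ B ∣ₚ C
  coprime-∣ₚ⇒⊗-∣ₚ {A} {B} {C} A-monic coprime A∣C (t , C≈) =
    r , ≈-trans C≈ (≈-trans (⊗-congˡ B t≈) (⊗-assoc r A B))
    where
    A∣t : A ∣ₚ t
    A∣t = coprime-∣ₚ⊗⇒∣ₚ A-monic coprime (∣ₚ-respʳ (≈-trans C≈ (⊗-comm t B)) A∣C)
    r = proj₁ A∣t
    t≈ = proj₂ A∣t

  prodP-++ : ∀ xs ys → prodP (xs ++ ys) ≈ prodP xs ⊗ prodP ys
  prodP-++ []       ys = ≈-sym (⊗-identityˡ (prodP ys))
  prodP-++ (x ∷ xs) ys = ≈-trans (⊗-congʳ x (prodP-++ xs ys)) (≈-sym (⊗-assoc x (prodP xs) (prodP ys)))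

  prodP-map-cong : ∀ {A : Set} {F G : A → Poly} {xs} → All (λ x → F x ≈ G x) xs → prodP (map F xs) ≈ prodP (map G xs)
  prodP-map-cong []           = ≈-refl
  prodP-map-cong (Fx≈Gx ∷ eqs) = ⊗-cong Fx≈Gx (prodP-map-cong eqs)

  prodP-∣ₚ : ∀ {C} Bs → AllPairs CoprimeOverℚ Bs → All Monic Bs → All (_∣ₚ C) Bs → prodP Bs ∣ₚ C × Monic (prodP Bs)
  prodP-∣ₚ {C} []       _                   _                 _              = one∣ₚ C , Monic-one
  prodP-∣ₚ     (B ∷ Bs) (coprimes ∷ pairs) (B-monic ∷ monics) (B∣C ∷ Bs∣C) with prodP-∣ₚ Bs pairs monics Bs∣C
  ... | ∏∣C , ∏-monic =
    coprime-∣ₚ⇒⊗-∣ₚ B-monic (CoprimeOverℚ-prodP Bs coprimes) B∣C ∏∣C , Monic-⊗ B (prodP Bs) B-monic ∏-monic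

module PowersMinusOne where

  open Polynomials
  open PolynomialSolver
  open LeadingTerms
  open Divisibility

  x^_−1 : ℕ → Poly
  x^ n −1 = mono n ⊕ neg one

  Monic-x^−1 : ∀ {n} → 1 ≤ n → Monic (x^ n −1)
  Monic-x^−1 {suc m} _ = suc m , LeadingTerm-resp-≈ {neg one ⊕ mono (suc m)} (⊕-comm (neg one) (mono (suc m)))
    (LeadingTerm-⊕ˡ {mono (suc m)} {neg one} (λ { zero () ; (suc i) _ → refl }) (LeadingTerm-monomial (suc m) 1ℤ))

  mono-+ : ∀ a b → mono a ⊗ mono b ≈ mono (a + b)
  mono-+ zero    b = ⊗-identityˡ (mono b)
  mono-+ (suc a) b = ≈-trans (0∷-⊗ (mono a) (mono b)) (∷-cong refl (mono-+ a b))

  x^−1-+ : ∀ c a → x^ (c + a) −1 ≈ mono c ⊗ x^ a −1 ⊕ x^ c −1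
  x^−1-+ c a = ≈-sym (≈-trans
    (solve 2 (λ C A → C :* (A :- con 1ℤ) :+ (C :- con 1ℤ) := C :* A :- con 1ℤ) ≈-refl (mono c) (mono a))
                             (⊕-cong (mono-+ c a) (≈-refl {neg one})))

  x^−1-⊗ : ∀ a p → x^ a −1 ⊗ p ≈ mono a ⊗ p ⊕ neg p
  x^−1-⊗ a p = solve 2 (λ A P → (A :- con 1ℤ) :* P := A :* P :- P) ≈-refl (mono a) p

  geometric : ℕ → ℕ → Poly
  geometric g zero    = []
  geometric g (suc m) = mono (g * m) ⊕ geometric g m

  x^−1-⊗-geometric : ∀ g m → x^ g −1 ⊗ geometric g m ≈ x^ (g * m) −1
  x^−1-⊗-geometric g zero =
    ≈-trans (⊗-zeroʳ (x^ g −1)) (≈-sym (subst (λ n → x^ n −1 ≈ []) (sym (ℕP.*-zeroʳ g)) x^0−1≈[]))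
    where
    x^0−1≈[] : x^ 0 −1 ≈ []
    x^0−1≈[] = 0∷-≈[] refl ≈-refl
  x^−1-⊗-geometric g (suc m) = begin
    x^ g −1 ⊗ (mono (g * m) ⊕ geometric g m)                ≈⟨ ⊗-distribˡ (x^ g −1) (mono (g * m)) (geometric g m) ⟩
    x^ g −1 ⊗ mono (g * m) ⊕ x^ g −1 ⊗ geometric g m        ≈⟨ ⊕-cong (⊗-comm (x^ g −1) (mono (g * m))) (x^−1-⊗-geometric g m) ⟩
    mono (g * m) ⊗ x^ g −1 ⊕ x^ (g * m) −1                  ≈⟨ x^−1-+ (g * m) g ⟨
    x^ (g * m + g) −1                                       ≡⟨ cong x^_−1 (trans (ℕP.+-comm (g * m) g) (sym (ℕP.*-suc g m))) ⟩
    x^ (g * suc m) −1                                       ∎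
    where open ≈-Reasoning

  x^−1-∣ₚ : ∀ {d n} → d ∣ n → x^ d −1 ∣ₚ x^ n −1
  x^−1-∣ₚ {d} (divides m refl) =
    geometric d m , ≈-trans (≡⇒≈ (cong x^_−1 (ℕP.*-comm m d)))
                            (≈-trans (≈-sym (x^−1-⊗-geometric d m)) (⊗-comm (x^ d −1) (geometric d m)))

  geometric≡length : ∀ g k → x^ g −1 ∣ₚ geometric g k ⊕ neg (const (+ k))
  geometric≡length g zero    = ∣ₚ-respʳ (≈-sym (0∷-≈[] (ℤP.*-zeroʳ (- 1ℤ)) ≈-refl)) (∣ₚ-[] (x^ g −1))
  geometric≡length g (suc k) =
    ∣ₚ-respʳ (≈-sym (solve 3 (λ M S K → (M :+ S) :- (con 1ℤ :+ K) := (M :- con 1ℤ) :+ (S :- K)) ≈-refl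
                             (mono (g * k)) (geometric g k) (const (+ k))))
             (∣ₚ-⊕ (x^−1-∣ₚ (m∣m*n k)) (geometric≡length g k))

  x^−1-∈⟨⟩ : ∀ {g m n x y} → g + y * n ≡ x * m → x^ g −1 ∈⟨ x^ m −1 , x^ n −1 ⟩
  x^−1-∈⟨⟩ {g} {m} {n} {x} {y} eq with x^−1-∣ₚ (n∣m*n x {m}) | x^−1-∣ₚ (n∣m*n y {n})
  ... | s , xm≈ | t , yn≈ = s , neg (mono g ⊗ t) , (begin
    s ⊗ x^ m −1 ⊕ neg (mono g ⊗ t) ⊗ x^ n −1
      ≈⟨ solve 5 (λ s t G A B → s :* A :+ (:- (G :* t)) :* B := s :* A :- G :* (t :* B)) ≈-refl s t (mono g) (x^ m −1) (x^ n −1) ⟩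
    s ⊗ x^ m −1 ⊕ neg (mono g ⊗ (t ⊗ x^ n −1))  ≈⟨ ⊕-cong (≈-sym xm≈) (neg-cong (⊗-congʳ (mono g) (≈-sym yn≈))) ⟩
    x^ (x * m) −1 ⊕ neg (mono g ⊗ x^ (y * n) −1) ≡⟨ cong (λ k → x^ k −1 ⊕ neg (mono g ⊗ x^ (y * n) −1)) eq ⟨
    x^ (g + y * n) −1 ⊕ neg (mono g ⊗ x^ (y * n) −1)
      ≈⟨ ⊕-cong (x^−1-+ g (y * n)) (≈-refl {neg (mono g ⊗ x^ (y * n) −1)}) ⟩
    mono g ⊗ x^ (y * n) −1 ⊕ x^ g −1 ⊕ neg (mono g ⊗ x^ (y * n) −1)
      ≈⟨ solve 2 (λ P Q → P :+ Q :- P := Q) ≈-refl (mono g ⊗ x^ (y * n) −1) (x^ g −1) ⟩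
    x^ g −1                                      ∎)
    where open ≈-Reasoning

  x^gcd−1∈⟨⟩ : ∀ a b → x^ gcd a b −1 ∈⟨ x^ a −1 , x^ b −1 ⟩
  x^gcd−1∈⟨⟩ a b with Bézout.identity (gcd-GCD a b)
  ... | Bézout.Identity.+- x y eq = x^−1-∈⟨⟩ {x = x} {y} eq
  ... | Bézout.Identity.-+ x y eq = ∈⟨⟩-swap (x^−1-∈⟨⟩ {x = y} {x} eq)

  -- Φ · (P / (x^g − 1)) = 1 + x^g + ⋯ + x^{g(k−1)} ≡ k  (mod x^g − 1).
  cofactor-∣ₚ⇒const∈⟨⟩ : ∀ {Φ′ P} g k → 1 ≤ g → Φ′ ⊗ P ≈ x^ (g * k) −1 → x^ g −1 ∣ₚ P →
    const (+ k) ∈⟨ Φ′ , x^ g −1 ⟩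
  cofactor-∣ₚ⇒const∈⟨⟩ {Φ′} {P} g k 1≤g Φ′P≈ (R , P≈) with geometric≡length g k
  ... | W , geometric-k≈ = R , neg W , (begin
    R ⊗ Φ′ ⊕ neg W ⊗ x^ g −1                     ≈⟨ ⊕-cong (≈-trans (⊗-comm R Φ′) Φ′R≈) (≈-refl {neg W ⊗ x^ g −1}) ⟩
    geometric g k ⊕ neg W ⊗ x^ g −1
      ≈⟨ ⊕-cong (≈-refl {geometric g k}) (solve 2 (λ W X → (:- W) :* X := :- (W :* X)) ≈-refl W (x^ g −1)) ⟩
    geometric g k ⊕ neg (W ⊗ x^ g −1)            ≈⟨ ⊕-cong (≈-refl {geometric g k}) (neg-cong geometric-k≈) ⟨
    geometric g k ⊕ neg (geometric g k ⊕ neg (const (+ k)))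
      ≈⟨ solve 2 (λ S K → S :+ (:- (S :- K)) := K) ≈-refl (geometric g k) (const (+ k)) ⟩
    const (+ k)                                  ∎)
    where
    open ≈-Reasoning
    Φ′R≈ : Φ′ ⊗ R ≈ geometric g k
    Φ′R≈ = ⊗-cancelʳ-monic (x^ g −1) (Monic-x^−1 1≤g) (begin
      Φ′ ⊗ R ⊗ x^ g −1        ≈⟨ ⊗-assoc Φ′ R (x^ g −1) ⟩
      Φ′ ⊗ (R ⊗ x^ g −1)      ≈⟨ ⊗-congʳ Φ′ P≈ ⟨
      Φ′ ⊗ P                  ≈⟨ Φ′P≈ ⟩
      x^ (g * k) −1           ≈⟨ x^−1-⊗-geometric g k ⟨
      x^ g −1 ⊗ geometric g k ≈⟨ ⊗-comm (x^ g −1) (geometric g k) ⟩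
      geometric g k ⊗ x^ g −1 ∎)

module CyclotomicPolynomials where

  open Polynomials
  open LeadingTerms
  open Stripping using (strip-≈[])
  open Divisibility
  open PowersMinusOne

  ∏Φ : List ℕ → Poly
  ∏Φ ds = prodP (map Φ ds)

  -- Φ n is computed from cycFuel (n ∸ 1) d rather than from Φ d = cycFuel d d,
  -- so the induction also has to show that surplus fuel does not change the result.
  record Cyclotomic (n : ℕ) : Set where
    field
      factorisation : Φ n ⊗ ∏Φ (properDivisors n) ≈ x^ n −1
      Φ-monic       : Monic (Φ n)
      ∏Φ-monic      : Monic (∏Φ (properDivisors n))
      fuel-stable   : ∀ f → n ≤ f → cycFuel f n ≈ Φ n

  open Cyclotomic

  CyclotomicBelow : ℕ → Set
  CyclotomicBelow n = ∀ d → 1 ≤ d → d < n → Cyclotomic d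

  Φ-∣ₚ-x^−1 : ∀ {d n} → Cyclotomic d → d ∣ n → Φ d ∣ₚ x^ n −1
  Φ-∣ₚ-x^−1 {d} Φd d∣n =
    ∣ₚ-trans (∏Φ (properDivisors d) , ≈-trans (≈-sym (factorisation Φd)) (⊗-comm (Φ d) (∏Φ (properDivisors d))))
             (x^−1-∣ₚ d∣n)

  ∏Φ-divisors : ∀ g → Cyclotomic (suc g) → ∏Φ (filter (_∣? suc g) (applyUpTo suc (suc g))) ≈ x^ suc g −1
  ∏Φ-divisors g Φn = begin
    ∏Φ (filter (_∣? n) (applyUpTo suc n))        ≡⟨ cong ∏Φ divisors≡ ⟩
    prodP (map Φ (properDivisors n ++ [ n ]))     ≡⟨ cong prodP (map-++ Φ (properDivisors n) [ n ]) ⟩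
    prodP (map Φ (properDivisors n) ++ [ Φ n ])   ≈⟨ prodP-++ (map Φ (properDivisors n)) [ Φ n ] ⟩
    ∏Φ (properDivisors n) ⊗ (Φ n ⊗ one)           ≈⟨ ⊗-congʳ (∏Φ (properDivisors n)) (⊗-identityʳ (Φ n)) ⟩
    ∏Φ (properDivisors n) ⊗ Φ n                   ≈⟨ ⊗-comm (∏Φ (properDivisors n)) (Φ n) ⟩
    Φ n ⊗ ∏Φ (properDivisors n)                   ≈⟨ factorisation Φn ⟩
    x^ n −1                                       ∎
    where
    open ≈-Reasoning
    n = suc g
    divisors≡ : filter (_∣? n) (applyUpTo suc n) ≡ properDivisors n ++ [ n ]
    divisors≡ = trans (cong (filter (_∣? n)) (sym (applyUpTo-∷ʳ suc g)))
                (trans (filter-++ (_∣? n) (applyUpTo suc g) [ n ])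
                       (cong (properDivisors n ++_) (filter-accept (_∣? n) {xs = []} ∣-refl)))

  prodP-filter-∣ₚ : (F : ℕ → Poly) {P Q : ℕ → Set} (P? : Decidable P) (Q? : Decidable Q) → (∀ {x} → P x → Q x) →
    ∀ f {m n} → m ≤ n → prodP (map F (filter P? (applyUpTo f m))) ∣ₚ prodP (map F (filter Q? (applyUpTo f n)))
  prodP-filter-∣ₚ F P? Q? P⇒Q f {zero}  {n}     _         = one∣ₚ _
  prodP-filter-∣ₚ F P? Q? P⇒Q f {suc m} {suc n} (s≤s m≤n) with P? (f 0) | Q? (f 0)
  ... | yes _  | yes _  = ⊗-monoˡ-∣ₚ (F (f 0)) (prodP-filter-∣ₚ F P? Q? P⇒Q (f ∘ suc) m≤n)
  ... | yes p  | no ¬q  = ⊥-elim (¬q (P⇒Q p))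
  ... | no _   | yes _  = ∣ₚ-⊗ˡ (F (f 0)) (prodP-filter-∣ₚ F P? Q? P⇒Q (f ∘ suc) m≤n)
  ... | no _   | no _   = prodP-filter-∣ₚ F P? Q? P⇒Q (f ∘ suc) m≤n

  x^−1-∣ₚ-∏Φ-proper : ∀ {g d} → Cyclotomic g → 1 ≤ g → g ∣ d → g < d → x^ g −1 ∣ₚ ∏Φ (properDivisors d)
  x^−1-∣ₚ-∏Φ-proper {suc g} {d} Φg _ g∣d g<d =
    ∣ₚ-respˡ (∏Φ-divisors g Φg)
      (prodP-filter-∣ₚ Φ (_∣? suc g) (_∣? d) (λ e∣g → ∣-trans e∣g g∣d) suc (ℕP.∸-monoˡ-≤ 1 g<d))

  Φ-coprime-x^−1 : ∀ {d g} → Cyclotomic d → Cyclotomic g → 1 ≤ g → g ∣ d → g < d → CoprimeOverℚ (Φ d) (x^ g −1)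
  Φ-coprime-x^−1 {d} {g} Φd Φg 1≤g g∣d@(divides k d≡kg) g<d =
    + k , k≢0 ,
    cofactor-∣ₚ⇒const∈⟨⟩ g k 1≤g (≈-trans (factorisation Φd) (≡⇒≈ (cong x^_−1 (trans d≡kg (ℕP.*-comm k g)))))
                         (x^−1-∣ₚ-∏Φ-proper Φg 1≤g g∣d g<d)
    where
    k≢0 : + k ≢ 0ℤ
    k≢0 k≡0 = ℕP.n≮0 (subst (g <_) (trans d≡kg (cong (_* g) (ℤP.+-injective k≡0))) g<d)

  private
    Φ-coprime-gcd< : ∀ {n d e} → CyclotomicBelow n → 1 ≤ d → 1 ≤ e → d < n → e < n → gcd d e < d →
      CoprimeOverℚ (Φ d) (Φ e)
    Φ-coprime-gcd< {n} {d} {e} below 1≤d 1≤e d<n e<n g<d = CoprimeOverℚ-absorb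
      (Φ-coprime-x^−1 Φd (below (gcd d e) 1≤g (ℕP.<-trans g<d d<n)) 1≤g (gcd[m,n]∣m d e) g<d)
      (∈⟨⟩-∣ₚ (x^gcd−1∈⟨⟩ d e) (Φ-∣ₚ-x^−1 Φd ∣-refl) (Φ-∣ₚ-x^−1 (below e 1≤e e<n) ∣-refl))
      where
      Φd = below d 1≤d d<n
      1≤g = ℕP.n≢0⇒n>0 (gcd[m,n]≢0 d e (inj₁ (ℕP.m<n⇒n≢0 1≤d)))

  Φ-coprime : ∀ {n d e} → CyclotomicBelow n → 1 ≤ d → 1 ≤ e → d < n → e < n → d ≢ e → CoprimeOverℚ (Φ d) (Φ e)
  Φ-coprime {n} {d} {e} below 1≤d 1≤e d<n e<n d≢e
    with ℕP.m≤n⇒m<n∨m≡n (∣⇒≤ {{ℕ.>-nonZero 1≤d}} (gcd[m,n]∣m d e))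
  ... | inj₁ g<d = Φ-coprime-gcd< below 1≤d 1≤e d<n e<n g<d
  ... | inj₂ g≡d = CoprimeOverℚ-swap (Φ-coprime-gcd< below 1≤e 1≤d e<n d<n g<e)
    where
    d∣e : d ∣ e
    d∣e = subst (_∣ e) g≡d (gcd[m,n]∣n d e)
    g<e : gcd e d < e
    g<e = subst (_< e) (trans (sym g≡d) (gcd-comm d e))
                (ℕP.≤∧≢⇒< (∣⇒≤ {{ℕ.>-nonZero 1≤e}} d∣e) d≢e)

  ProperDivisor : ℕ → ℕ → Set
  ProperDivisor n d = (1 ≤ d × d < n) × d ∣ n

  properDivisors-proper : ∀ m → All (ProperDivisor (suc m)) (properDivisors (suc m))
  properDivisors-proper m = All.zip
    (AllP.filter⁺ (_∣? suc m) (AllP.applyUpTo⁺₁ suc m (λ i<m → s≤s z≤n , s≤s i<m)) ,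
     AllP.all-filter (_∣? suc m) (applyUpTo suc m))

  properDivisors-unique : ∀ m → Unique (properDivisors (suc m))
  properDivisors-unique m =
    UniqueP.filter⁺ (_∣? suc m) (UniqueP.applyUpTo⁺₁ suc m (λ i<j _ eq → ℕP.<-irrefl (ℕP.suc-injective eq) i<j))

  ∏Φ-proper-∣ₚ : ∀ m → CyclotomicBelow (suc m) →
    ∏Φ (properDivisors (suc m)) ∣ₚ x^ suc m −1 × Monic (∏Φ (properDivisors (suc m)))
  ∏Φ-proper-∣ₚ m below = prodP-∣ₚ (map Φ ds) (pairwise ds proper (properDivisors-unique m))
    (AllP.map⁺ (All.map (λ ((1≤d , d<n) , _) → Φ-monic (below _ 1≤d d<n)) proper))
    (AllP.map⁺ (All.map (λ ((1≤d , d<n) , d∣n) → Φ-∣ₚ-x^−1 (below _ 1≤d d<n) d∣n) proper))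
    where
    ds = properDivisors (suc m)
    proper = properDivisors-proper m
    pairwise : ∀ L → All (ProperDivisor (suc m)) L → Unique L → AllPairs CoprimeOverℚ (map Φ L)
    pairwise []      []                           []                 = []
    pairwise (d ∷ L) (((1≤d , d<n) , _) ∷ L-ok) (d∉L ∷ L-unique) =
      AllP.map⁺ (All.zipWith (λ (d≢e , ((1≤e , e<n) , _)) → Φ-coprime below 1≤d 1≤e d<n e<n d≢e) (d∉L , L-ok))
      ∷ pairwise L L-ok L-unique

  cyclotomic-step : ∀ m → CyclotomicBelow (suc m) → Cyclotomic (suc m)
  cyclotomic-step m below = record
    { factorisation = exact m ℕP.≤-refl
    ; Φ-monic       = Monic-cancelʳ (Φ n) ∏-monic (Monic-resp-≈ (≈-sym (exact m ℕP.≤-refl)) (Monic-x^−1 (s≤s z≤n)))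
    ; ∏Φ-monic      = ∏-monic
    ; fuel-stable   = stable
    }
    where
    n = suc m
    ∏ = ∏Φ (properDivisors n)
    ∏∣x^n−1 = proj₁ (∏Φ-proper-∣ₚ m below)
    ∏-monic = proj₂ (∏Φ-proper-∣ₚ m below)
    ∏-fuel : ℕ → Poly
    ∏-fuel f = prodP (map (cycFuel f) (properDivisors n))
    ∏-fuel≈ : ∀ f → m ≤ f → ∏-fuel f ≈ ∏
    ∏-fuel≈ f m≤f = prodP-map-cong (All.map
      (λ ((1≤d , d<n) , _) → fuel-stable (below _ 1≤d d<n) f (ℕP.≤-trans (ℕP.≤-pred d<n) m≤f))
      (properDivisors-proper m))
    exact : ∀ f → m ≤ f → cycFuel (suc f) n ⊗ ∏ ≈ x^ n −1
    exact f m≤f = ≈-trans (⊗-congʳ (cycFuel (suc f) n) (≈-sym (∏-fuel≈ f m≤f)))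
      (∣ₚ⇒quotM-exact (x^ n −1) (∏-fuel f) (Monic-resp-≈ (≈-sym (∏-fuel≈ f m≤f)) ∏-monic)
                                          (∣ₚ-respˡ (≈-sym (∏-fuel≈ f m≤f)) ∏∣x^n−1))
    stable : ∀ f → n ≤ f → cycFuel f n ≈ Φ n
    stable (suc f) (s≤s m≤f) = ⊗-cancelʳ-monic ∏ ∏-monic (≈-trans (exact f m≤f) (≈-sym (exact m ℕP.≤-refl)))

  cyclotomic : ∀ n → 1 ≤ n → Cyclotomic n
  cyclotomic = <-rec (λ n → 1 ≤ n → Cyclotomic n) λ where
    (suc m) rec _ → cyclotomic-step m λ d 1≤d d<n → rec d<n 1≤d

  Φ-coprime-x^a−1 : ∀ {M a} → 1 ≤ a → a < M → CoprimeOverℚ (Φ M) (x^ a −1)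
  Φ-coprime-x^a−1 {M} {a} 1≤a a<M = CoprimeOverℚ-absorb
    (Φ-coprime-x^−1 ΦM (cyclotomic g 1≤g) 1≤g (gcd[m,n]∣n a M) (ℕP.≤-<-trans g≤a a<M))
    (∈⟨⟩-swap (∈⟨⟩-∣ₚ (x^gcd−1∈⟨⟩ a M) (∣ₚ-refl (x^ a −1)) (Φ-∣ₚ-x^−1 ΦM ∣-refl)))
    where
    ΦM = cyclotomic M (ℕP.≤-trans 1≤a (ℕP.<⇒≤ a<M))
    g = gcd a M
    1≤g = ℕP.n≢0⇒n>0 (gcd[m,n]≢0 a M (inj₁ (ℕP.m<n⇒n≢0 1≤a)))
    g≤a = ∣⇒≤ {{ℕ.>-nonZero 1≤a}} (gcd[m,n]∣m a M)

  Φ-∣ₚ⇒VanishesAt : ∀ M {p} → 1 ≤ M → Φ M ∣ₚ p → VanishesAt M p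
  Φ-∣ₚ⇒VanishesAt M {p} 1≤M Φ∣p = strip-≈[] (remM p (Φ M)) (∣ₚ⇒rem≈[] p (Φ M) (Φ-monic (cyclotomic M 1≤M)) Φ∣p)

module LcmCriterion where

  open ℕSolver.+-*-Solver

  -- With h = gcd n₂ d, the number n₁h = gcd (n₁n₂) (n₁d) divides d n₂ u₁ and d n₂ n₁, hence their
  -- gcd d n₂ = h · lcm n₂ d (as gcd u₁ n₁ = 1); then cancel h.
  n₁∣lcm[n₂,d] : ∀ n₁ n₂ d u₁ u₂ → d ≢ 0 → gcd u₁ n₁ ≡ 1 →
    n₁ * n₂ ∣ d * (n₂ * u₁ + n₁ * u₂) → n₁ ∣ lcm n₂ d
  n₁∣lcm[n₂,d] n₁ n₂ d u₁ u₂ d≢0 coprime n₁n₂∣ =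
    *-cancelˡ-∣ h {{ℕ.≢-nonZero (gcd[m,n]≢0 n₂ d (inj₂ d≢0))}}
      (subst₂ _∣_ (trans (sym (c*gcd[m,n]≡gcd[cm,cn] n₁ n₂ d)) (ℕP.*-comm n₁ h)) (sym (gcd*lcm n₂ d)) G∣n₂d)
    where
    h = gcd n₂ d
    G = gcd (n₁ * n₂) (n₁ * d)
    G∣n₁n₂ : G ∣ n₁ * n₂
    G∣n₁n₂ = gcd[m,n]∣m (n₁ * n₂) (n₁ * d)
    G∣n₁d : G ∣ n₁ * d
    G∣n₁d = gcd[m,n]∣n (n₁ * n₂) (n₁ * d)
    G∣dn₂u₁ : G ∣ d * n₂ * u₁
    G∣dn₂u₁ = ∣m+n∣m⇒∣n
      (subst (G ∣_) (solve 5 (λ d n₂ u₁ n₁ u₂ → d :* (n₂ :* u₁ :+ n₁ :* u₂) := d :* n₁ :* u₂ :+ d :* n₂ :* u₁)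
                             refl d n₂ u₁ n₁ u₂)
             (∣-trans G∣n₁n₂ n₁n₂∣))
      (∣-trans G∣n₁d (subst (n₁ * d ∣_) (solve 3 (λ n₁ d u₂ → n₁ :* d :* u₂ := d :* n₁ :* u₂) refl n₁ d u₂) (m∣m*n u₂)))
    G∣dn₂n₁ : G ∣ d * n₂ * n₁
    G∣dn₂n₁ = ∣-trans G∣n₁n₂
      (subst (n₁ * n₂ ∣_) (solve 3 (λ n₁ n₂ d → n₁ :* n₂ :* d := d :* n₂ :* n₁) refl n₁ n₂ d) (m∣m*n d))
    G∣n₂d : G ∣ n₂ * d
    G∣n₂d = subst (G ∣_)
      (trans (sym (c*gcd[m,n]≡gcd[cm,cn] (d * n₂) u₁ n₁))
             (trans (cong (d * n₂ *_) coprime) (solve 2 (λ d n₂ → d :* n₂ :* con 1 := n₂ :* d) refl d n₂)))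
      (gcd-greatest G∣dn₂u₁ G∣dn₂n₁)

  lcm[n₁,d]≡lcm[n₂,d] : ∀ n₁ n₂ d u₁ u₂ → d ≢ 0 → gcd u₁ n₁ ≡ 1 → gcd u₂ n₂ ≡ 1 →
    n₁ * n₂ ∣ d * (n₂ * u₁ + n₁ * u₂) → lcm n₁ d ≡ lcm n₂ d
  lcm[n₁,d]≡lcm[n₂,d] n₁ n₂ d u₁ u₂ d≢0 coprime₁ coprime₂ n₁n₂∣ = ∣-antisym
    (lcm-least (n₁∣lcm[n₂,d] n₁ n₂ d u₁ u₂ d≢0 coprime₁ n₁n₂∣) (n∣lcm[m,n] n₂ d))
    (lcm-least (n₁∣lcm[n₂,d] n₂ n₁ d u₂ u₁ d≢0 coprime₂ n₂n₁∣) (n∣lcm[m,n] n₁ d))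
    where
    n₂n₁∣ : n₂ * n₁ ∣ d * (n₁ * u₂ + n₂ * u₁)
    n₂n₁∣ = subst₂ _∣_ (ℕP.*-comm n₁ n₂) (cong (d *_) (ℕP.+-comm (n₂ * u₁) (n₁ * u₂))) n₁n₂∣

module ListSums {c ℓ} (R : CommutativeRing c ℓ) where

  open CommutativeRing R
    using (Carrier; _≈_; 0#; +-cong; +-congˡ; +-identityˡ; distribˡ; zeroʳ; *-comm; +-commutativeSemigroup)
    renaming (_+_ to _+ᴿ_; _*_ to _*ᴿ_; refl to ≈-refl; sym to ≈-sym; trans to ≈-trans)
  open import Algebra.Properties.CommutativeSemigroup +-commutativeSemigroup using (interchange)

  ∑ : {A : Set} → List A → (A → Carrier) → Carrier
  ∑ xs f = foldr _+ᴿ_ 0# (map f xs)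

  ∑-cong : ∀ {A : Set} (xs : List A) {f g : A → Carrier} → (∀ x → f x ≈ g x) → ∑ xs f ≈ ∑ xs g
  ∑-cong []       f≈g = ≈-refl
  ∑-cong (x ∷ xs) f≈g = +-cong (f≈g x) (∑-cong xs f≈g)

  ∑-zero : ∀ {A : Set} {xs : List A} {f : A → Carrier} → All (λ x → f x ≈ 0#) xs → ∑ xs f ≈ 0#
  ∑-zero []           = ≈-refl
  ∑-zero (fx≈0 ∷ rest) = ≈-trans (+-cong fx≈0 (∑-zero rest)) (+-identityˡ 0#)

  ∑-+ : ∀ {A : Set} (xs : List A) (f g : A → Carrier) → ∑ xs (λ x → f x +ᴿ g x) ≈ ∑ xs f +ᴿ ∑ xs g
  ∑-+ []       f g = ≈-sym (+-identityˡ 0#)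
  ∑-+ (x ∷ xs) f g = ≈-trans (+-congˡ (∑-+ xs f g)) (interchange (f x) (g x) (∑ xs f) (∑ xs g))

  *-∑ : ∀ {A : Set} (xs : List A) (k : Carrier) (f : A → Carrier) → k *ᴿ ∑ xs f ≈ ∑ xs (λ x → k *ᴿ f x)
  *-∑ []       k f = zeroʳ k
  *-∑ (x ∷ xs) k f = ≈-trans (distribˡ k (f x) (∑ xs f)) (+-congˡ (*-∑ xs k f))

  ∑-* : ∀ {A : Set} (xs : List A) (k : Carrier) (f : A → Carrier) → ∑ xs f *ᴿ k ≈ ∑ xs (λ x → f x *ᴿ k)
  ∑-* xs k f = ≈-trans (*-comm (∑ xs f) k) (≈-trans (*-∑ xs k f) (∑-cong xs λ x → *-comm k (f x)))

  ∑-comm : ∀ {A B : Set} (xs : List A) (ys : List B) (F : A → B → Carrier) →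
    ∑ xs (λ x → ∑ ys (F x)) ≈ ∑ ys (λ y → ∑ xs (λ x → F x y))
  ∑-comm []       ys F = ≈-sym (∑-zero {xs = ys} (All.tabulate λ _ → ≈-refl))
  ∑-comm (x ∷ xs) ys F = ≈-trans (+-congˡ (∑-comm xs ys F)) (≈-sym (∑-+ ys (F x) λ y → ∑ xs λ x → F x y))

  ∑-*-∑ : ∀ {A B : Set} (xs : List A) (ys : List B) (f : A → Carrier) (g : B → Carrier) →
    ∑ xs f *ᴿ ∑ ys g ≈ ∑ xs (λ x → ∑ ys (λ y → f x *ᴿ g y))
  ∑-*-∑ xs ys f g = ≈-trans (∑-* xs (∑ ys g) f) (∑-cong xs λ x → *-∑ ys (f x) g)

module Congruence (m : Poly) where

  open Polynomials
  open PolynomialSolver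
  open Divisibility

  infix 4 _≋_
  record _≋_ (p q : Poly) : Set where
    constructor by-∣ₚ
    field ∣ₚ-difference : m ∣ₚ p ⊕ neg q
  open _≋_ public

  ≈⇒≋ : ∀ {p q} → p ≈ q → p ≋ q
  ≈⇒≋ {p} {q} p≈q = by-∣ₚ (∣ₚ-respʳ (≈-sym (≈-trans (⊕-cong p≈q (≈-refl {neg q})) (⊕-inverseʳ q))) (∣ₚ-[] m))

  ≡⇒≋ : ∀ {p q} → p ≡ q → p ≋ q
  ≡⇒≋ refl = ≈⇒≋ ≈-refl

  ≋-refl : ∀ {p} → p ≋ p
  ≋-refl = ≈⇒≋ ≈-refl

  ≋-sym : ∀ {p q} → p ≋ q → q ≋ p
  ≋-sym {p} {q} (by-∣ₚ m∣) = by-∣ₚ (∣ₚ-respʳ (solve 2 (λ p q → :- (p :- q) := q :- p) ≈-refl p q) (∣ₚ-neg m∣))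

  ≋-trans : ∀ {p q r} → p ≋ q → q ≋ r → p ≋ r
  ≋-trans {p} {q} {r} (by-∣ₚ m∣p−q) (by-∣ₚ m∣q−r) =
    by-∣ₚ (∣ₚ-respʳ (solve 3 (λ p q r → (p :- q) :+ (q :- r) := p :- r) ≈-refl p q r) (∣ₚ-⊕ m∣p−q m∣q−r))

  ⊕-cong-≋ : ∀ {p p′ q q′} → p ≋ p′ → q ≋ q′ → p ⊕ q ≋ p′ ⊕ q′
  ⊕-cong-≋ {p} {p′} {q} {q′} (by-∣ₚ m∣p−p′) (by-∣ₚ m∣q−q′) =
    by-∣ₚ (∣ₚ-respʳ (solve 4 (λ p p′ q q′ → (p :- p′) :+ (q :- q′) := (p :+ q) :- (p′ :+ q′)) ≈-refl p p′ q q′)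
                    (∣ₚ-⊕ m∣p−p′ m∣q−q′))

  neg-cong-≋ : ∀ {p p′} → p ≋ p′ → neg p ≋ neg p′
  neg-cong-≋ {p} {p′} (by-∣ₚ m∣p−p′) =
    by-∣ₚ (∣ₚ-respʳ (solve 2 (λ p p′ → :- (p :- p′) := (:- p) :- (:- p′)) ≈-refl p p′) (∣ₚ-neg m∣p−p′))

  ⊗-cong-≋ : ∀ {p p′ q q′} → p ≋ p′ → q ≋ q′ → p ⊗ q ≋ p′ ⊗ q′
  ⊗-cong-≋ {p} {p′} {q} {q′} (by-∣ₚ m∣p−p′) (by-∣ₚ m∣q−q′) =
    by-∣ₚ (∣ₚ-respʳ (solve 4 (λ p p′ q q′ → q :* (p :- p′) :+ p′ :* (q :- q′) := (p :* q) :- (p′ :* q′))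
                             ≈-refl p p′ q q′)
                    (∣ₚ-⊕ (∣ₚ-⊗ˡ q m∣p−p′) (∣ₚ-⊗ˡ p′ m∣q−q′)))

  quotientRing : CommutativeRing _ _
  quotientRing = record
    { Carrier = Poly ; _≈_ = _≋_ ; _+_ = _⊕_ ; _*_ = _⊗_ ; -_ = neg ; 0# = [] ; 1# = one
    ; isCommutativeRing = record
      { isRing = record
        { +-isAbelianGroup = record
          { isGroup = record
            { isMonoid = record
              { isSemigroup = record
                { isMagma = record
                  { isEquivalence = record { refl = ≋-refl ; sym = ≋-sym ; trans = ≋-trans }
                  ; ∙-cong = ⊕-cong-≋ }
                ; assoc = λ p q r → ≈⇒≋ (⊕-assoc p q r) }
              ; identity = (λ p → ≈⇒≋ (⊕-identityˡ p)) , (λ p → ≈⇒≋ (⊕-identityʳ p)) }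
            ; inverse = (λ p → ≈⇒≋ (⊕-inverseˡ p)) , (λ p → ≈⇒≋ (⊕-inverseʳ p))
            ; ⁻¹-cong = neg-cong-≋ }
          ; comm = λ p q → ≈⇒≋ (⊕-comm p q) }
        ; *-cong = ⊗-cong-≋
        ; *-assoc = λ p q r → ≈⇒≋ (⊗-assoc p q r)
        ; *-identity = (λ p → ≈⇒≋ (⊗-identityˡ p)) , (λ p → ≈⇒≋ (⊗-identityʳ p))
        ; distrib = (λ p q r → ≈⇒≋ (⊗-distribˡ p q r)) , (λ r p q → ≈⇒≋ (⊗-distribʳ p q r)) }
      ; *-comm = λ p q → ≈⇒≋ (⊗-comm p q) } }

  module ≋-Reasoning = SetoidReasoning (CommutativeRing.setoid quotientRing)

  ≋[]⇒∣ₚ : ∀ {p} → p ≋ [] → m ∣ₚ p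
  ≋[]⇒∣ₚ {p} (by-∣ₚ m∣) = ∣ₚ-respʳ (⊕-identityʳ p) m∣

  ∣ₚ⇒≋[] : ∀ {p} → m ∣ₚ p → p ≋ []
  ∣ₚ⇒≋[] {p} m∣p = by-∣ₚ (∣ₚ-respʳ (≈-sym (⊕-identityʳ p)) m∣p)

module RootsOfUnity (M′ : ℕ) where

  M : ℕ
  M = suc M′

  open Polynomials
  open PolynomialSolver using (const)
  open Divisibility
  open PowersMinusOne
  open CyclotomicPolynomials
  open Congruence (Φ M)
  open ℤSolver.+-*-Solver

  ζ^_ : ℤ → Poly
  ζ^ z = mono (z %ℕ M)

  mono-period : ∀ r q → mono (r + q * M) ≋ mono r
  mono-period r q = begin
    mono (r + q * M)         ≈⟨ ≈⇒≋ (mono-+ r (q * M)) ⟨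
    mono r ⊗ mono (q * M)    ≈⟨ ⊗-cong-≋ (≋-refl {mono r}) x^qM≋1 ⟩
    mono r ⊗ one             ≈⟨ ≈⇒≋ (⊗-identityʳ (mono r)) ⟩
    mono r                   ∎
    where
    open ≋-Reasoning
    x^qM≋1 : mono (q * M) ≋ one
    x^qM≋1 = by-∣ₚ (∣ₚ-trans (Φ-∣ₚ-x^−1 (cyclotomic M (s≤s z≤n)) ∣-refl) (x^−1-∣ₚ (n∣m*n q)))

  mono-≋ : ∀ a b t → + a ≡ + b +ℤ t *ℤ + M → mono a ≋ mono b
  mono-≋ a b (+ q) eq = ≋-trans (≡⇒≋ (cong mono (ℤP.+-injective a≡))) (mono-period b q)
    where
    a≡ : + a ≡ + (b + q * M)
    a≡ = trans eq (trans (cong (+ b +ℤ_) (sym (ℤP.pos-* q M))) (sym (ℤP.pos-+ b (q * M))))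
  mono-≋ a b -[1+ q ] eq = ≋-sym (≋-trans (≡⇒≋ (cong mono (ℤP.+-injective b≡))) (mono-period a (suc q)))
    where
    b≡ : + b ≡ + (a + suc q * M)
    b≡ = trans (solve 3 (λ b t m → b := (b :+ (:- t) :* m) :+ t :* m) refl (+ b) (+ suc q) (+ M))
         (trans (cong (_+ℤ + suc q *ℤ + M) (sym eq)) (trans (cong (+ a +ℤ_) (sym (ℤP.pos-* (suc q) M))) (sym (ℤP.pos-+ a (suc q * M)))))

  residue : ∀ z → z ≡ + (z %ℕ M) +ℤ (z /ℕ M) *ℤ + M
  residue z = a≡a%ℕn+[a/ℕn]*n z M

  mono≋ζ^ : ∀ a z t → + a ≡ z +ℤ t *ℤ + M → mono a ≋ ζ^ z
  mono≋ζ^ a z t eq = mono-≋ a (z %ℕ M) (t +ℤ z /ℕ M) (begin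
    + a                                          ≡⟨ eq ⟩
    z +ℤ t *ℤ + M                                ≡⟨ cong (_+ℤ t *ℤ + M) (residue z) ⟩
    + (z %ℕ M) +ℤ (z /ℕ M) *ℤ + M +ℤ t *ℤ + M
      ≡⟨ solve 4 (λ r q t m → r :+ q :* m :+ t :* m := r :+ (t :+ q) :* m) refl (+ (z %ℕ M)) (z /ℕ M) t (+ M) ⟩
    + (z %ℕ M) +ℤ (t +ℤ z /ℕ M) *ℤ + M           ∎)
    where open ≡-Reasoning

  ζ^-periodic : ∀ z w t → z ≡ w +ℤ t *ℤ + M → ζ^ z ≋ ζ^ w
  ζ^-periodic z w t eq = mono≋ζ^ (z %ℕ M) w (t +ℤ - (z /ℕ M)) (begin
    + (z %ℕ M)
      ≡⟨ solve 3 (λ r q m → r := r :+ q :* m :- q :* m) refl (+ (z %ℕ M)) (z /ℕ M) (+ M) ⟩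
    + (z %ℕ M) +ℤ (z /ℕ M) *ℤ + M +ℤ - ((z /ℕ M) *ℤ + M)  ≡⟨ cong (_+ℤ - ((z /ℕ M) *ℤ + M)) (trans (sym (residue z)) eq) ⟩
    w +ℤ t *ℤ + M +ℤ - ((z /ℕ M) *ℤ + M)
      ≡⟨ solve 4 (λ w t q m → w :+ t :* m :- q :* m := w :+ (t :- q) :* m) refl w t (z /ℕ M) (+ M) ⟩
    w +ℤ (t +ℤ - (z /ℕ M)) *ℤ + M                          ∎)
    where open ≡-Reasoning

  ζ^-+ : ∀ z w → ζ^ z ⊗ ζ^ w ≋ ζ^ (z +ℤ w)
  ζ^-+ z w = ≋-trans (≈⇒≋ (mono-+ (z %ℕ M) (w %ℕ M))) (mono≋ζ^ (z %ℕ M + w %ℕ M) (z +ℤ w) (- (z /ℕ M +ℤ w /ℕ M)) (begin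
    + (z %ℕ M + w %ℕ M)                   ≡⟨ ℤP.pos-+ (z %ℕ M) (w %ℕ M) ⟩
    + (z %ℕ M) +ℤ + (w %ℕ M)
      ≡⟨ solve 5 (λ a b p q m → a :+ b := (a :+ p :* m) :+ (b :+ q :* m) :- (p :+ q) :* m) refl
               (+ (z %ℕ M)) (+ (w %ℕ M)) (z /ℕ M) (w /ℕ M) (+ M) ⟩
    (+ (z %ℕ M) +ℤ (z /ℕ M) *ℤ + M) +ℤ (+ (w %ℕ M) +ℤ (w /ℕ M) *ℤ + M) +ℤ - ((z /ℕ M +ℤ w /ℕ M) *ℤ + M)
      ≡⟨ cong (_+ℤ - ((z /ℕ M +ℤ w /ℕ M) *ℤ + M)) (sym (cong₂ _+ℤ_ (residue z) (residue w))) ⟩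
    z +ℤ w +ℤ - ((z /ℕ M +ℤ w /ℕ M) *ℤ + M)
      ≡⟨ solve 3 (λ s q m → s :- q :* m := s :+ (:- q) :* m) refl (z +ℤ w) (z /ℕ M +ℤ w /ℕ M) (+ M) ⟩
    z +ℤ w +ℤ - (z /ℕ M +ℤ w /ℕ M) *ℤ + M ∎))
    where open ≡-Reasoning

  sumUpTo : ℕ → (ℕ → Poly) → Poly
  sumUpTo zero    f = []
  sumUpTo (suc m) f = f 0 ⊕ sumUpTo m (f ∘ suc)

  sumP-applyUpTo : ∀ m h (f : ℕ → Poly) → sumP (map f (applyUpTo h m)) ≡ sumUpTo m (f ∘ h)
  sumP-applyUpTo zero    h f = refl
  sumP-applyUpTo (suc m) h f = cong (f (h 0) ⊕_) (sumP-applyUpTo m (h ∘ suc) f)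

  sumUpTo-cong : ∀ m {f g : ℕ → Poly} → (∀ k → f k ≋ g k) → sumUpTo m f ≋ sumUpTo m g
  sumUpTo-cong zero    f≋g = ≋-refl
  sumUpTo-cong (suc m) f≋g = ⊕-cong-≋ (f≋g 0) (sumUpTo-cong m (f≋g ∘ suc))

  sumUpTo-∷ʳ : ∀ m f → sumUpTo (suc m) f ≈ sumUpTo m f ⊕ f m
  sumUpTo-∷ʳ zero    f = ≈-trans (⊕-identityʳ (f 0)) (≈-sym (⊕-identityˡ (f 0)))
  sumUpTo-∷ʳ (suc m) f = ≈-trans (⊕-cong (≈-refl {f 0}) (sumUpTo-∷ʳ m (f ∘ suc)))
                                 (≈-sym (⊕-assoc (f 0) (sumUpTo m (f ∘ suc)) (f (suc m))))

  ⊗-sumUpTo : ∀ m c f → c ⊗ sumUpTo m f ≈ sumUpTo m (λ k → c ⊗ f k)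
  ⊗-sumUpTo zero    c f = ⊗-zeroʳ c
  ⊗-sumUpTo (suc m) c f = ≈-trans (⊗-distribˡ c (f 0) (sumUpTo m (f ∘ suc))) (⊕-cong ≈-refl (⊗-sumUpTo m c (f ∘ suc)))

  -- The terms are permuted cyclically; the last one wraps around to the first because M ∣ Nγ.
  ζ^γ-⊗-geometric : ∀ γ N′ s → suc N′ * γ ≡ s * M →
    ζ^ (+ γ) ⊗ sumUpTo (suc N′) (λ k → ζ^ (- (+ γ *ℤ + k))) ≋ sumUpTo (suc N′) (λ k → ζ^ (- (+ γ *ℤ + k)))
  ζ^γ-⊗-geometric γ N′ s Nγ≡sM = begin
    ζ^ (+ γ) ⊗ sumUpTo (suc N′) g                              ≈⟨ ≈⇒≋ (⊗-sumUpTo (suc N′) (ζ^ (+ γ)) g) ⟩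
    sumUpTo (suc N′) (λ k → ζ^ (+ γ) ⊗ g k)                   ≈⟨ sumUpTo-cong (suc N′) (λ k → ζ^-+ (+ γ) (- (+ γ *ℤ + k))) ⟩
    sumUpTo (suc N′) (λ k → ζ^ (+ γ +ℤ - (+ γ *ℤ + k)))
      ≈⟨ ⊕-cong-≋ (ζ^-periodic (+ γ +ℤ - (+ γ *ℤ 0ℤ)) (- (+ γ *ℤ + N′)) (+ s) head≡)
                  (sumUpTo-cong N′ λ k → ≡⇒≋ (cong ζ^_ (tail≡ k))) ⟩
    g N′ ⊕ sumUpTo N′ g                                        ≈⟨ ≈⇒≋ (⊕-comm (g N′) (sumUpTo N′ g)) ⟩
    sumUpTo N′ g ⊕ g N′                                        ≈⟨ ≈⇒≋ (sumUpTo-∷ʳ N′ g) ⟨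
    sumUpTo (suc N′) g                                         ∎
    where
    open ≋-Reasoning
    g : ℕ → Poly
    g k = ζ^ (- (+ γ *ℤ + k))
    head≡ : + γ +ℤ - (+ γ *ℤ 0ℤ) ≡ - (+ γ *ℤ + N′) +ℤ + s *ℤ + M
    head≡ = trans (solve 2 (λ γ n → γ :- γ :* con 0ℤ := :- (γ :* n) :+ (con 1ℤ :+ n) :* γ) refl (+ γ) (+ N′))
                  (cong (- (+ γ *ℤ + N′) +ℤ_) (trans (sym (ℤP.pos-* (suc N′) γ)) (trans (cong +_ Nγ≡sM) (ℤP.pos-* s M))))
    tail≡ : ∀ k → + γ +ℤ - (+ γ *ℤ + suc k) ≡ - (+ γ *ℤ + k)
    tail≡ k = solve 2 (λ γ k → γ :- γ :* (con 1ℤ :+ k) := :- (γ :* k)) refl (+ γ) (+ k)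

  geometric-ζ-vanishes : ∀ γ N → M ∣ N * γ → ¬ M ∣ γ → sumP (map (λ k → ζ^ (- (+ γ *ℤ + k))) (upTo N)) ≋ []
  geometric-ζ-vanishes γ zero    _     _    = ≋-refl
  geometric-ζ-vanishes γ (suc N′) (divides s Nγ≡sM) M∤γ rewrite sumP-applyUpTo (suc N′) (λ k → k) (λ k → ζ^ (- (+ γ *ℤ + k))) =
    ∣ₚ⇒≋[] (coprime-∣ₚ⊗⇒∣ₚ (Cyclotomic.Φ-monic (cyclotomic M (s≤s z≤n))) (Φ-coprime-x^a−1 1≤a a<M) (≋[]⇒∣ₚ kills))
    where
    G = sumUpTo (suc N′) (λ k → ζ^ (- (+ γ *ℤ + k)))
    a = γ ℕ.% M
    a<M : a < M
    a<M = ℕDivMod.m%n<n γ M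
    1≤a : 1 ≤ a
    1≤a = ℕP.n≢0⇒n>0 λ a≡0 → M∤γ (m%n≡0⇒n∣m γ M a≡0)
    kills : x^ a −1 ⊗ G ≋ []
    kills = begin
      x^ a −1 ⊗ G              ≈⟨ ≈⇒≋ (x^−1-⊗ a G) ⟩
      mono a ⊗ G ⊕ neg G       ≈⟨ ⊕-cong-≋ (ζ^γ-⊗-geometric γ N′ s Nγ≡sM) ≋-refl ⟩
      G ⊕ neg G                ≈⟨ ≈⇒≋ (⊕-inverseʳ G) ⟩
      []                       ∎
      where open ≋-Reasoning

module ExponentialSums (a₁ a₂ d′ : ℕ) where

  n₁ n₂ d : ℕ
  n₁ = suc a₁
  n₂ = suc a₂
  d  = suc d′

  -- suc M′ is n₁ * n₂ * d by computation, as RootsOfUnity needs the modulus in successor form.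
  open RootsOfUnity (d′ + (a₂ + a₁ * n₂) * d)

  open Polynomials using (⊗-zeroʳ)
  open Divisibility
  open CyclotomicPolynomials
  open LcmCriterion
  open Congruence (Φ M)
  open ListSums quotientRing

  Index : Set
  Index = ℕ × ℕ × ℕ × ℕ

  indices : ℕ → List Index
  indices n = concatMap (λ u → concatMap (λ y₁ → concatMap (λ y₂ → map (λ y₃ → u , y₁ , y₂ , y₃)
                (upTo n)) (upTo n)) (upTo n)) (units n)

  indices-units : ∀ n → All (λ w → gcd (proj₁ w) n ≡ 1) (indices n)
  indices-units n = All-concatMap (λ u-unit → All-concatMap (λ _ → All-concatMap (λ _ →
      AllP.map⁺ (All.tabulate λ _ → u-unit)) all-y) all-y)
    (AllP.all-filter (λ u → gcd u n ℕ.≟ 1) (upTo n))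
    where
    all-y : All (λ _ → ⊤) (upTo n)
    all-y = All.tabulate λ _ → tt
    All-concatMap : ∀ {A B : Set} {P : B → Set} {Q : A → Set} {f : A → List B} {xs} →
      (∀ {x} → Q x → All P (f x)) → All Q xs → All P (concatMap f xs)
    All-concatMap {f = f} h qs = AllP.concat⁺ (AllP.map⁺ {f = f} (All.map h qs))

  phase : ℕ → ℤ → Index → ℤ
  phase n b (u , y₁ , y₂ , y₃) = + (M divN n) *ℤ (+ u *ℤ F b (+ y₁) (+ y₂) (+ y₃))

  T-as-∑ : ∀ b n → T M b n ≡ ∑ (indices n) (ζ^_ ∘ phase n b)
  T-as-∑ b n = cong sumP (sym (trans (map-concatMap g _ (units n))
    (concatMap-cong (λ u → trans (map-concatMap g _ (upTo n))
      (concatMap-cong (λ y₁ → trans (map-concatMap g _ (upTo n))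
        (concatMap-cong (λ y₂ → sym (map-∘ (upTo n))) (upTo n))) (upTo n))) (units n))))
    where
    g = ζ^_ ∘ phase n b

  slope : ℕ → Index → ℕ
  slope n (u , _) = (M divN n) * u * d

  phase-linear : ∀ n w k → phase n (+ (d * k)) w ≡ phase n 0ℤ w +ℤ - (+ slope n w *ℤ + k)
  phase-linear n w@(u , y₁ , y₂ , y₃) k = begin
    + K *ℤ (+ u *ℤ (c +ℤ - + (d * k)))             ≡⟨ cong (λ x → + K *ℤ (+ u *ℤ (c +ℤ - x))) (ℤP.pos-* d k) ⟩
    + K *ℤ (+ u *ℤ (c +ℤ - (+ d *ℤ + k)))
      ≡⟨ solve 5 (λ K u c d k → K :* (u :* (c :- d :* k)) := K :* (u :* (c :- con 0ℤ)) :- (K :* u :* d) :* k)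
                 refl (+ K) (+ u) c (+ d) (+ k) ⟩
    phase n 0ℤ w +ℤ - (+ K *ℤ + u *ℤ + d *ℤ + k)    ≡⟨ cong (λ x → phase n 0ℤ w +ℤ - (x *ℤ + k)) slope≡ ⟨
    phase n 0ℤ w +ℤ - (+ slope n w *ℤ + k)          ∎
    where
    open ≡-Reasoning
    open ℤSolver.+-*-Solver
    K = M divN n
    c = + y₁ *ℤ + y₁ *ℤ + y₁ +ℤ + y₂ *ℤ + y₂ *ℤ + y₂ +ℤ + y₃ *ℤ + y₃ *ℤ + y₃
    slope≡ : + slope n w ≡ + K *ℤ + u *ℤ + d
    slope≡ = trans (ℤP.pos-* (K * u) d) (cong (_*ℤ + d) (ℤP.pos-* K u))

  N : ℕ
  N = n₁ * n₂

  M/n₁ : M divN n₁ ≡ n₂ * d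
  M/n₁ = trans (cong (ℕDivMod._/ n₁) (solve 3 (λ a b c → a :* b :* c := (b :* c) :* a) refl n₁ n₂ d))
               (ℕDivMod.m*n/n≡m (n₂ * d) n₁)
    where open ℕSolver.+-*-Solver

  M/n₂ : M divN n₂ ≡ n₁ * d
  M/n₂ = trans (cong (ℕDivMod._/ n₂) (solve 3 (λ a b c → a :* b :* c := (a :* c) :* b) refl n₁ n₂ d))
               (ℕDivMod.m*n/n≡m (n₁ * d) n₂)
    where open ℕSolver.+-*-Solver

  γ : Index → Index → ℕ
  γ w₁ w₂ = slope n₁ w₁ + slope n₂ w₂

  γ≡ : ∀ w₁ w₂ → γ w₁ w₂ ≡ d * (d * (n₂ * proj₁ w₁ + n₁ * proj₁ w₂))
  γ≡ (u₁ , _) (u₂ , _) = trans (cong₂ (λ K₁ K₂ → K₁ * u₁ * d + K₂ * u₂ * d) M/n₁ M/n₂)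
    (solve 5 (λ n₁ n₂ d u₁ u₂ → n₂ :* d :* u₁ :* d :+ n₁ :* d :* u₂ :* d := d :* (d :* (n₂ :* u₁ :+ n₁ :* u₂)))
                                refl n₁ n₂ d u₁ u₂)
    where open ℕSolver.+-*-Solver

  term-split : ∀ w₁ w₂ k → ζ^ (phase n₁ (+ (d * k)) w₁) ⊗ ζ^ (phase n₂ (+ (d * k)) w₂) ≋
                           ζ^ (phase n₁ 0ℤ w₁ +ℤ phase n₂ 0ℤ w₂) ⊗ ζ^ (- (+ γ w₁ w₂ *ℤ + k))
  term-split w₁ w₂ k = ≋-trans (ζ^-+ (phase n₁ (+ (d * k)) w₁) (phase n₂ (+ (d * k)) w₂))
    (≋-trans (≡⇒≋ (cong ζ^_ exponent≡)) (≋-sym (ζ^-+ (phase n₁ 0ℤ w₁ +ℤ phase n₂ 0ℤ w₂) (- (+ γ w₁ w₂ *ℤ + k)))))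
    where
    open ℤSolver.+-*-Solver
    exponent≡ : phase n₁ (+ (d * k)) w₁ +ℤ phase n₂ (+ (d * k)) w₂ ≡
                phase n₁ 0ℤ w₁ +ℤ phase n₂ 0ℤ w₂ +ℤ - (+ γ w₁ w₂ *ℤ + k)
    exponent≡ = trans (cong₂ _+ℤ_ (phase-linear n₁ w₁ k) (phase-linear n₂ w₂ k))
      (trans (solve 5 (λ a₁ a₂ s₁ s₂ k → (a₁ :- s₁ :* k) :+ (a₂ :- s₂ :* k) := (a₁ :+ a₂) :- (s₁ :+ s₂) :* k) refl
                      (phase n₁ 0ℤ w₁) (phase n₂ 0ℤ w₂) (+ slope n₁ w₁) (+ slope n₂ w₂) (+ k))
             (cong (λ s → phase n₁ 0ℤ w₁ +ℤ phase n₂ 0ℤ w₂ +ℤ - (s *ℤ + k)) (sym (ℤP.pos-+ (slope n₁ w₁) (slope n₂ w₂)))))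

  inner-sum-vanishes : lcm n₁ d ≢ lcm n₂ d → ∀ w₁ w₂ → gcd (proj₁ w₁) n₁ ≡ 1 → gcd (proj₁ w₂) n₂ ≡ 1 →
    ∑ (upTo N) (λ k → ζ^ (- (+ γ w₁ w₂ *ℤ + k))) ≋ []
  inner-sum-vanishes lcm≢ w₁@(u₁ , _) w₂@(u₂ , _) unit₁ unit₂ = geometric-ζ-vanishes (γ w₁ w₂) N M∣Nγ M∤γ
    where
    open ℕSolver.+-*-Solver
    M∣Nγ : M ∣ N * γ w₁ w₂
    M∣Nγ = divides (n₂ * u₁ * d + n₁ * u₂ * d) (trans (cong (N *_) (γ≡ w₁ w₂))
      (solve 5 (λ n₁ n₂ d u₁ u₂ → n₁ :* n₂ :* (d :* (d :* (n₂ :* u₁ :+ n₁ :* u₂)))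
                                    := (n₂ :* u₁ :* d :+ n₁ :* u₂ :* d) :* (n₁ :* n₂ :* d)) refl n₁ n₂ d u₁ u₂))
    M∤γ : ¬ M ∣ γ w₁ w₂
    M∤γ M∣γ = lcm≢ (lcm[n₁,d]≡lcm[n₂,d] n₁ n₂ d u₁ u₂ (λ ()) unit₁ unit₂ (*-cancelˡ-∣ d dN∣))
      where
      dN∣ : d * N ∣ d * (d * (n₂ * u₁ + n₁ * u₂))
      dN∣ = subst₂ _∣_ (solve 3 (λ a b c → a :* b :* c := c :* (a :* b)) refl n₁ n₂ d) (γ≡ w₁ w₂) M∣γ

  S≋[] : lcm n₁ d ≢ lcm n₂ d → S n₁ n₂ d ≋ []
  S≋[] lcm≢ = begin
    ∑ (upTo N) (λ k → T M (+ (d * k)) n₁ ⊗ T M (+ (d * k)) n₂)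
      ≈⟨ ∑-cong (upTo N) (λ k → ≋-trans (≡⇒≋ (cong₂ _⊗_ (T-as-∑ _ n₁) (T-as-∑ _ n₂)))
                                        (∑-*-∑ (indices n₁) (indices n₂) _ _)) ⟩
    ∑ (upTo N) (λ k → ∑ (indices n₁) λ w₁ → ∑ (indices n₂) λ w₂ →
                       ζ^ (phase n₁ (+ (d * k)) w₁) ⊗ ζ^ (phase n₂ (+ (d * k)) w₂))
      ≈⟨ ∑-cong (upTo N) (λ k → ∑-cong (indices n₁) λ w₁ → ∑-cong (indices n₂) λ w₂ → term-split w₁ w₂ k) ⟩
    ∑ (upTo N) (λ k → ∑ (indices n₁) λ w₁ → ∑ (indices n₂) λ w₂ → ζ^ (A w₁ w₂) ⊗ G w₁ w₂ k)
      ≈⟨ ∑-comm (upTo N) (indices n₁) _ ⟩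
    ∑ (indices n₁) (λ w₁ → ∑ (upTo N) λ k → ∑ (indices n₂) λ w₂ → ζ^ (A w₁ w₂) ⊗ G w₁ w₂ k)
      ≈⟨ ∑-cong (indices n₁) (λ w₁ → ∑-comm (upTo N) (indices n₂) _) ⟩
    ∑ (indices n₁) (λ w₁ → ∑ (indices n₂) λ w₂ → ∑ (upTo N) λ k → ζ^ (A w₁ w₂) ⊗ G w₁ w₂ k)
      ≈⟨ ∑-cong (indices n₁) (λ w₁ → ∑-cong (indices n₂) λ w₂ → ≋-sym (*-∑ (upTo N) (ζ^ (A w₁ w₂)) (G w₁ w₂))) ⟩
    ∑ (indices n₁) (λ w₁ → ∑ (indices n₂) λ w₂ → ζ^ (A w₁ w₂) ⊗ ∑ (upTo N) (G w₁ w₂))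
      ≈⟨ ∑-zero (All.map (λ {w₁} unit₁ → ∑-zero (All.map (λ {w₂} unit₂ →
           ≋-trans (⊗-cong-≋ (≋-refl {ζ^ (A w₁ w₂)}) (inner-sum-vanishes lcm≢ w₁ w₂ unit₁ unit₂))
                   (≈⇒≋ (⊗-zeroʳ (ζ^ (A w₁ w₂)))))
           (indices-units n₂))) (indices-units n₁)) ⟩
    [] ∎
    where
    open ≋-Reasoning
    A : Index → Index → ℤ
    A w₁ w₂ = phase n₁ 0ℤ w₁ +ℤ phase n₂ 0ℤ w₂
    G : Index → Index → ℕ → Poly
    G w₁ w₂ k = ζ^ (- (+ γ w₁ w₂ *ℤ + k))

  Φ-∣ₚ-S : lcm n₁ d ≢ lcm n₂ d → Φ (n₁ * n₂ * d) ∣ₚ S n₁ n₂ d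
  Φ-∣ₚ-S lcm≢ = ≋[]⇒∣ₚ (S≋[] lcm≢)

lemma2p7 : (n₁ n₂ d : ℕ) → 1 ≤ n₁ → 1 ≤ n₂ → 1 ≤ d →
    lcm n₁ d ≢ lcm n₂ d →
    VanishesAt (n₁ * n₂ * d) (S n₁ n₂ d)
lemma2p7 n₁@(suc a₁) n₂@(suc a₂) d@(suc d′) _ _ _ lcm≢ =
  Φ-∣ₚ⇒VanishesAt (n₁ * n₂ * d) (s≤s z≤n) (Φ-∣ₚ-S a₁ a₂ d′ lcm≢)
  where
  open CyclotomicPolynomials using (Φ-∣ₚ⇒VanishesAt)
  open ExponentialSums using (Φ-∣ₚ-S)
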